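{- Let $g$ be an arithmetic function with $g(1) = 1$. Let $s_{n,k} := [q^n]\, (q;q)_\infty \frac{q^k}{1-q^k}$ for $n,k \ge 1$, let $\widetilde{s}_{n,k}(g) := \sum_{j=1}^n s_{n,kj}\, g(j)$, and let $(s^{(-1)}_{n,k}(g))_{n,k\ge1}$ be the inverse of the lower-triangular matrix $(\widetilde{s}_{n,k}(g))_{n,k \geq 1}$. Then for all $n, k \geq 1$, \[ \sum_{d|n} s_{d,k}^{(-1)}(g) = p_k(n) + \sum_{j=1}^{\Omega(n)} (p_k \ast \mathrm{ds}_{2j,g})(n) = p_k(n) + (p_k \ast D_{g})(n), \] equivalently (by Möbius inversion) \[ s_{n,k}^{(-1)}(g) = (p_k \ast \mu)(n) + \sum_{j=1}^{\Omega(n)} (p_k \ast \mathrm{ds}_{2j,g} \ast \mu)(n) = (p_k \ast \mu)(n) + (p_k \ast D_{g} \ast \mu)(n). \]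
   Context: $(q;q)_\infty := \prod_{j\ge1}(1-q^j)$ and $[q^n]F(q)$ is the coefficient of $q^n$. Convention $s_{n,m}:=0$ for $m>n$. $(f\ast h)(n) := \sum_{d|n} f(d)h(n/d)$ is Dirichlet convolution, $\mu$ is the Möbius function, $\Omega(n)$ is the number of prime factors of $n$ counted with multiplicity. $p(m)$ is Euler's partition function with $p(m) := 0$ for $m<0$, and $p_k$ is the arithmetic function $p_k(n) := p(n-k)$. Define $g_{\pm}(n) := g(n)$ for $n>1$ and $g_{\pm}(1) := -1$, and recursively $\mathrm{ds}_{1,g}(n) := g_{\pm}(n)$, $\mathrm{ds}_{j,g}(n) := \sum_{d|n,\ d>1} g(d)\, \mathrm{ds}_{j-1,g}(n/d)$ for $j>1$. Finally $D_g(m) := \sum_{j=1}^{m} \mathrm{ds}_{2j,g}(m)$. -}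

module Defs where

open import Level using (Level)
open import Data.Bool using (Bool; true; false; if_then_else_)
open import Data.Nat using (ℕ; zero; suc; _∸_; _≤ᵇ_; _≡ᵇ_; _/_)
open import Data.Nat as N using ()
open import Data.Nat.Divisibility using (_∣?_)
open import Data.Nat.Primality.Factorisation using (factorise; factors)
open import Data.List using (List; length)
open import Data.List.Relation.Unary.Unique.DecPropositional (Data.Nat._≟_) using (unique?)
open import Relation.Nullary using (does)
open import Algebra.Bundles using (CommutativeRing)

-- Ω(n): number of prime factors of n counted with multiplicity,
-- read off the library prime factorisation (only meaningful for n ≥ 1).
Ω : ℕ → ℕ
Ω zero    = zero
Ω (suc n) = length (factors (factorise (suc n)))

squarefree : ℕ → Bool
squarefree zero    = false
squarefree (suc n) = does (unique? (factors (factorise (suc n))))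

-- partsUpTo k m = number of partitions of m into parts of size ≤ k,
-- counted by choosing the multiplicity i of the largest allowed part k.
partsUpTo : ℕ → ℕ → ℕ
partsUpTo zero    m = if m ≡ᵇ 0 then 1 else 0
partsUpTo (suc k) m = go m
  where
  go : ℕ → ℕ
  go zero    = partsUpTo k m
  go (suc i) = go i N.+ (if suc i N.* suc k ≤ᵇ m then partsUpTo k (m ∸ suc i N.* suc k) else 0)

-- Euler's partition function p(m) (every part of a partition of m is ≤ m).
partition : ℕ → ℕ
partition m = partsUpTo m m

module WithRing {c ℓ : Level} (R : CommutativeRing c ℓ) where
  open CommutativeRing R

  ι : ℕ → Carrier
  ι zero    = 0#
  ι (suc n) = 1# + ι n

  sum1 : ℕ → (ℕ → Carrier) → Carrier
  sum1 zero    f = 0#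
  sum1 (suc n) f = sum1 n f + f (suc n)

  δ : ℕ → ℕ → Carrier
  δ n k = if n ≡ᵇ k then 1# else 0#

  divSum : ℕ → (ℕ → Carrier) → Carrier
  divSum n f = sum1 n (λ d → if does (d ∣? n) then f d else 0#)

  _⋆_ : (ℕ → Carrier) → (ℕ → Carrier) → ℕ → Carrier
  (f ⋆ h) n = sum1 n (λ { zero → 0#
                        ; (suc i) → if does (suc i ∣? n) then f (suc i) * h (n / suc i) else 0# })

  negOnePow : ℕ → Carrier
  negOnePow zero    = 1#
  negOnePow (suc j) = - negOnePow j

  μ : ℕ → Carrier
  μ n = if squarefree n then negOnePow (Ω n) else 0#

  pₖ : ℕ → ℕ → Carrier
  pₖ k n = if k ≤ᵇ n then ι (partition (n ∸ k)) else 0#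

  -- coefficient of q^n in ∏_{i=1}^{j} (1 - q^i)
  eulerPartial : ℕ → ℕ → Carrier
  eulerPartial zero    n = if n ≡ᵇ 0 then 1# else 0#
  eulerPartial (suc j) n =
    eulerPartial j n - (if suc j ≤ᵇ n then eulerPartial j (n ∸ suc j) else 0#)

  -- [q^n] (q;q)_∞ : factors (1 - q^i) with i > n do not affect q^n
  eulerCoeff : ℕ → Carrier
  eulerCoeff n = eulerPartial n n

  -- s_{n,k} = [q^n] (q;q)_∞ q^k/(1-q^k) = Σ_{i ≥ 1, ik ≤ n} [q^{n-ik}] (q;q)_∞   (k ≥ 1)
  s : ℕ → ℕ → Carrier
  s n k = sum1 n (λ i → if i N.* k ≤ᵇ n then eulerCoeff (n ∸ i N.* k) else 0#)

  s̃ : (ℕ → Carrier) → ℕ → ℕ → Carrier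
  s̃ g n k = sum1 n (λ j → s n (k N.* j) * g j)

  g± : (ℕ → Carrier) → ℕ → Carrier
  g± g 1 = - 1#
  g± g n = g n

  dsStep : (ℕ → Carrier) → (ℕ → Carrier) → ℕ → Carrier
  dsStep g h n =
    sum1 n (λ { zero → 0#
              ; (suc zero) → 0#
              ; (suc (suc i)) → if does (suc (suc i) ∣? n)
                                  then g (suc (suc i)) * h (n / suc (suc i))
                                  else 0# })

  ds : ℕ → (ℕ → Carrier) → ℕ → Carrier
  ds zero          g n = 0#       -- unused (j ≥ 1 in the paper)
  ds (suc zero)    g n = g± g n
  ds (suc (suc j)) g n = dsStep g (ds (suc j) g) n

  D : (ℕ → Carrier) → ℕ → Carrier
  D g m = sum1 m (λ j → ds (2 N.* j) g m)

  IsInverseOfS̃ : (ℕ → Carrier) → (ℕ → ℕ → Carrier) → Set ℓ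
  IsInverseOfS̃ g t =
      (∀ n k → 1 Data.Nat.≤ n → n Data.Nat.< k → t n k ≈ 0#)
    Data.Product.× (∀ n k → 1 Data.Nat.≤ n → 1 Data.Nat.≤ k →
                      sum1 n (λ m → s̃ g n m * t m k) ≈ δ n k)
    Data.Product.× (∀ n k → 1 Data.Nat.≤ n → 1 Data.Nat.≤ k →
                      sum1 n (λ m → t n m * s̃ g m k) ≈ δ n k)
    where import Data.Product

module Submission where

-- Write g = δ₁ + g₀, so that g₀(1) = 0 and ds_{j+1,g} = g₀^{⋆(j+1)} − g₀^{⋆j} for Dirichlet powers.
-- Then (δ₁ + Σ_{j≤M} ds_{2j,g}) ⋆ g telescopes to δ₁ + g₀^{⋆(2M+1)}, and g₀^{⋆i}(m) = 0 as soon as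
-- i ≥ m, so δ₁ + D_g is the Dirichlet inverse of g. Expanding s̃, row n of s̃ · s⁻¹ = I reads
-- Σ_r [q^{n-r}](q;q)_∞ · (g ⋆ u)(r) = δ_{n,k} with u(n) = Σ_{d|n} s⁻¹_{d,k}; as (q;q)_∞ and Σ p(m) q^m
-- are inverse power series, g ⋆ u = p_k, hence u = p_k + p_k ⋆ D_g. The sum over j stops at Ω(n)
-- because g₀^{⋆i}(m) = 0 also once i > Ω(m), and Möbius inversion turns u back into s⁻¹.

open import Defs
open import Level using (Level)
open import Data.Bool using (Bool; true; false; if_then_else_)
open import Data.Empty using (⊥-elim)
open import Data.List using ([]; _∷_; _++_; length)
open import Data.List.Membership.Propositional using (_∈_)
open import Data.List.Properties using (length-++)
open import Data.List.Relation.Unary.All using (_∷_)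
open import Data.List.Relation.Unary.All.Properties using (++⁺; All¬⇒¬Any; ¬Any⇒All¬)
open import Data.List.Relation.Unary.AllPairs using (_∷_)
open import Data.List.Relation.Unary.Unique.Propositional using (Unique)
open import Data.List.Relation.Binary.Permutation.Propositional using (_↭_; ↭-sym; ↭⇒↭ₛ)
open import Data.List.Relation.Binary.Permutation.Propositional.Properties using (↭-length)
open import Data.List.Relation.Binary.Permutation.Setoid.Properties using (Unique-resp-↭)
open import Data.Nat as N using (ℕ; zero; suc; _≤_; _<_; z≤n; s≤s; _∸_; _≡ᵇ_; _≤ᵇ_; _/_; NonZero)
open import Data.Nat.Properties as ℕₚ using ()
open import Data.List.Relation.Unary.Unique.DecPropositional N._≟_ using (unique?)
open import Data.Nat.Divisibility using (_∣_; divides; _∣?_; ∣-trans; n∣m*n; ∣⇒≤)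
open import Data.Nat.DivMod using (m*n/n≡m; n/1≡n)
open import Data.Nat.ListAction using (product)
open import Data.Nat.ListAction.Properties using (product-++; ∈⇒∣product)
open import Data.Nat.Primality using (Prime; euclidsLemma; prime⇒nonZero)
open import Data.Nat.Primality.Factorisation
  using (PrimeFactorisation; factors; factorise; factorisationUnique;
         factorisationHasAllPrimeFactors; primeFactorisation[p])
open import Data.Product using (∃-syntax; _×_; _,_)
open import Data.Sum using (inj₁; inj₂)
open import Relation.Binary.PropositionalEquality as ≡ using (_≡_)
open import Relation.Nullary using (Dec; yes; no; does; ¬_)
open import Relation.Nullary.Decidable using (dec-true; dec-false; does-⇔)
open import Function.Bundles using (_⇔_; mk⇔)
open import Algebra.Bundles using (CommutativeRing)

open PrimeFactorisation using (isFactorisation; factorsPrime)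

module _ {a p} {A : Set a} {P : Set p} where

  if-yes : (d : Dec P) {x y : A} → P → (if does d then x else y) ≡ x
  if-yes (yes _) _ = ≡.refl
  if-yes (no ¬p) p = ⊥-elim (¬p p)

  if-no : (d : Dec P) {x y : A} → ¬ P → (if does d then x else y) ≡ y
  if-no (yes p) ¬p = ⊥-elim (¬p p)
  if-no (no _)  _  = ≡.refl

module FactorBounds where
  open import Data.Nat using (_*_)

  *≡⇒≤ʳ : ∀ {a b n} → 1 ≤ a → a * b ≡ n → b ≤ n
  *≡⇒≤ʳ {suc a} {b} _ ≡.refl = ℕₚ.m≤m+n b (a * b)

  *≡⇒≤ˡ : ∀ {a b n} → 1 ≤ b → a * b ≡ n → a ≤ n
  *≡⇒≤ˡ {a} {b} 1≤b ab≡n = *≡⇒≤ʳ 1≤b (≡.trans (ℕₚ.*-comm b a) ab≡n)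

  *≡⇒1≤ˡ : ∀ {a b n} → 1 ≤ n → a * b ≡ n → 1 ≤ a
  *≡⇒1≤ˡ {zero}  () ≡.refl
  *≡⇒1≤ˡ {suc _} _  _ = s≤s z≤n

  *≡⇒1≤ʳ : ∀ {a b n} → 1 ≤ n → a * b ≡ n → 1 ≤ b
  *≡⇒1≤ʳ {a} {b} 1≤n ab≡n = *≡⇒1≤ˡ 1≤n (≡.trans (ℕₚ.*-comm b a) ab≡n)

  *≡⇒<ʳ : ∀ {a b n} → 2 ≤ a → 1 ≤ b → a * b ≡ n → b < n
  *≡⇒<ʳ {suc zero} (s≤s ()) _ _
  *≡⇒<ʳ {suc (suc a)} {b} _ 1≤b ≡.refl = ℕₚ.<-≤-trans (ℕₚ.m<m+n b 1≤b) (ℕₚ.+-monoʳ-≤ b (ℕₚ.m≤m+n b (a * b)))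

open FactorBounds

DecreasesOnProperDivisors : (ℕ → ℕ) → Set
DecreasesOnProperDivisors ρ = ∀ a b → 2 ≤ a → 1 ≤ b → ρ b < ρ (a N.* b)

pred-decreases : DecreasesOnProperDivisors N.pred
pred-decreases a (suc b) 2≤a _ with a N.* suc b | *≡⇒<ʳ {a} {suc b} 2≤a (s≤s z≤n) ≡.refl
... | suc _ | s≤s b<ab = b<ab

module PrimeFactorCount where
  open import Data.Nat using (_+_; _*_)

  _·_ : ∀ {a b} → PrimeFactorisation a → PrimeFactorisation b → PrimeFactorisation (a * b)
  f · g = record
    { factors         = factors f ++ factors g
    ; isFactorisation = ≡.trans (≡.cong₂ _*_ (isFactorisation f) (isFactorisation g))
                                (≡.sym (product-++ (factors f) (factors g)))
    ; factorsPrime    = ++⁺ (factorsPrime f) (factorsPrime g)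
    }

  Ω≡length-factors : ∀ n (f : PrimeFactorisation (suc n)) → Ω (suc n) ≡ length (factors f)
  Ω≡length-factors n f = ↭-length (factorisationUnique (factorise (suc n)) f)

  squarefree≡unique? : ∀ n (f : PrimeFactorisation (suc n)) →
                       squarefree (suc n) ≡ does (unique? (factors f))
  squarefree≡unique? n f = does-⇔ (mk⇔ (resp fs↭) (resp (↭-sym fs↭))) (unique? _) (unique? _)
    where
    fs↭ : factors (factorise (suc n)) ↭ factors f
    fs↭ = factorisationUnique (factorise (suc n)) f
    resp : ∀ {xs ys} → xs ↭ ys → Unique xs → Unique ys
    resp xs↭ys = Unique-resp-↭ (≡.setoid ℕ) (↭⇒↭ₛ xs↭ys)

  Ω-* : ∀ a b → Ω (suc a * suc b) ≡ Ω (suc a) + Ω (suc b)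
  Ω-* a b = ≡.trans (Ω≡length-factors _ (factorise (suc a) · factorise (suc b)))
                    (length-++ (factors (factorise (suc a))))

  Ω-prime-* : ∀ {p} → Prime p → ∀ e → Ω (p * suc e) ≡ suc (Ω (suc e))
  Ω-prime-* {suc _} pr e = Ω≡length-factors _ (primeFactorisation[p] pr · factorise (suc e))

  ∈-factors⇒∣ : ∀ {p n} (f : PrimeFactorisation n) → p ∈ factors f → p ∣ n
  ∈-factors⇒∣ {p} f p∈ = ≡.subst (p ∣_) (≡.sym (isFactorisation f)) (∈⇒∣product p∈)

  prime∣⇒∈-factors : ∀ {p n} → Prime p → (f : PrimeFactorisation n) → p ∣ n → p ∈ factors f
  prime∣⇒∈-factors {p} pr f p∣n =
    factorisationHasAllPrimeFactors pr (≡.subst (p ∣_) (isFactorisation f) p∣n) (factorsPrime f)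

  squarefree-prime-* : ∀ {p} → Prime p → ∀ e →
    squarefree (p * suc e) ≡ (if does (p ∣? suc e) then false else squarefree (suc e))
  squarefree-prime-* {p@(suc _)} pr e =
    ≡.trans (squarefree≡unique? _ (primeFactorisation[p] pr · f)) (by-cases (p ∣? suc e))
    where
    f : PrimeFactorisation (suc e)
    f = factorise (suc e)
    select : Bool → Bool
    select b = if b then false else squarefree (suc e)
    by-cases : Dec (p ∣ suc e) → does (unique? (p ∷ factors f)) ≡ select (does (p ∣? suc e))
    by-cases (yes p∣) = ≡.trans (dec-false (unique? (p ∷ factors f))
                                           λ { (p∉ ∷ _) → All¬⇒¬Any p∉ (prime∣⇒∈-factors pr f p∣) })
                                (≡.cong select (≡.sym (dec-true (p ∣? suc e) p∣)))
    by-cases (no p∤) = ≡.trans (does-⇔ (mk⇔ (λ { (_ ∷ u) → u })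
                                            (λ u → ¬Any⇒All¬ _ (λ p∈ → p∤ (∈-factors⇒∣ f p∈)) ∷ u))
                                       (unique? (p ∷ factors f)) (unique? (factors f)))
                               (≡.cong select (≡.sym (dec-false (p ∣? suc e) p∤)))

  prime-divisor : ∀ n → 2 ≤ n → ∃[ p ] Prime p × p ∣ n
  prime-divisor n@(suc _) 2≤n with factorise n
  ... | record { factors = [] ; isFactorisation = n≡1 } = ⊥-elim (ℕₚ.<-irrefl (≡.sym n≡1) 2≤n)
  ... | record { factors = p ∷ ps ; isFactorisation = n≡ ; factorsPrime = pr ∷ _ } =
    p , pr , divides (product ps) (≡.trans n≡ (ℕₚ.*-comm p (product ps)))

  length-factors-positive : ∀ {n} (f : PrimeFactorisation n) → 2 ≤ n → 1 ≤ length (factors f)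
  length-factors-positive record { factors = [] ; isFactorisation = n≡1 } 2≤n = ⊥-elim (ℕₚ.<-irrefl (≡.sym n≡1) 2≤n)
  length-factors-positive record { factors = _ ∷ _ } _ = s≤s z≤n

  Ω-≤-* : ∀ a b → 1 ≤ a → 1 ≤ b → Ω b ≤ Ω (a * b)
  Ω-≤-* (suc a) (suc b) _ _ = ≡.subst (Ω (suc b) ≤_) (≡.sym (Ω-* a b)) (ℕₚ.m≤n+m _ _)

  Ω-decreases : DecreasesOnProperDivisors Ω
  Ω-decreases (suc a) (suc b) 2≤a _ = ≡.subst (Ω (suc b) <_) (≡.sym (Ω-* a b))
    (ℕₚ.+-monoˡ-≤ (Ω (suc b)) (length-factors-positive (factorise (suc a)) 2≤a))

  prime*∣ : ∀ {p n e} → Prime p → p ∣ n → ¬ p ∣ e → e ∣ n → p * e ∣ n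
  prime*∣ {p} {e = e} pr p∣n p∤e (divides q ≡.refl) with euclidsLemma q e pr p∣n
  ... | inj₂ p∣e = ⊥-elim (p∤e p∣e)
  ... | inj₁ (divides r ≡.refl) = divides r (ℕₚ.*-assoc r p e)

open PrimeFactorCount

module PartitionRecurrence where
  open import Data.Nat using (_+_; _*_)

  -- The local counter `go` of `partsUpTo (suc k) m`: partitions of m into parts ≤ suc k in which
  -- the part suc k occurs at most i times. It is named by letting unification solve the meta
  -- against the private equation below.
  mutual
    partsUpTo-go : ℕ → ℕ → ℕ → ℕ
    partsUpTo-go = _

    private
      partsUpTo-go-unfold : ∀ k m → partsUpTo (suc k) (suc m) ≡
        partsUpTo-go k (suc m) m + (if suc m * suc k ≤ᵇ suc m then partsUpTo k (suc m ∸ suc m * suc k) else 0)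
      partsUpTo-go-unfold k m with suc m
      ... | _ = ≡.refl

  partsUpTo-go-saturates : ∀ k m i → m ≤ i → partsUpTo-go k m i ≡ partsUpTo (suc k) m
  partsUpTo-go-saturates k m i m≤i =
    ≡.subst (λ i → partsUpTo-go k m i ≡ partsUpTo-go k m m) (ℕₚ.m∸n+n≡m m≤i) (beyond (i ∸ m))
    where
    beyond : ∀ d → partsUpTo-go k m (d + m) ≡ partsUpTo-go k m m
    beyond zero    = ≡.refl
    beyond (suc d) = ≡.trans (≡.cong₂ _+_ (beyond d) (if-no (suc (d + m) * suc k N.≤? m) (ℕₚ.<⇒≱ too-big)))
                             (ℕₚ.+-identityʳ _)
      where
      too-big : m < suc (d + m) * suc k
      too-big = ℕₚ.<-≤-trans (s≤s (ℕₚ.m≤n+m m d)) (ℕₚ.m≤m*n (suc (d + m)) (suc k))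

  partsUpTo-go-suc : ∀ k m i →
    partsUpTo-go k m (suc i) ≡ partsUpTo k m + (if suc k ≤ᵇ m then partsUpTo-go k (m ∸ suc k) i else 0)
  partsUpTo-go-suc k m zero rewrite ℕₚ.+-identityʳ k with suc k ≤ᵇ m
  ... | true  = ≡.refl
  ... | false = ≡.refl
  partsUpTo-go-suc k m (suc i) = ≡.trans (≡.cong (_+ last) (partsUpTo-go-suc k m i)) (by-cases (c N.≤? m))
    where
    open ≡.≡-Reasoning
    c a P : ℕ
    c = suc k
    a = suc i * c
    P = partsUpTo k m
    G : ℕ → ℕ
    G = partsUpTo-go k (m ∸ c)
    last : ℕ
    last = if c + a ≤ᵇ m then partsUpTo k (m ∸ (c + a)) else 0
    by-cases : Dec (c ≤ m) → P + (if c ≤ᵇ m then G i else 0) + last ≡ P + (if c ≤ᵇ m then G (suc i) else 0)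
    by-cases (yes c≤m) = begin
      P + (if c ≤ᵇ m then G i else 0) + last  ≡⟨ ≡.cong (λ x → P + x + last) (if-yes (c N.≤? m) c≤m) ⟩
      P + G i + last                          ≡⟨ ℕₚ.+-assoc P (G i) last ⟩
      P + (G i + last)                        ≡⟨ ≡.cong (λ x → P + (G i + x)) last≡ ⟩
      P + G (suc i)                           ≡⟨ ≡.cong (P +_) (if-yes (c N.≤? m) c≤m) ⟨
      P + (if c ≤ᵇ m then G (suc i) else 0)   ∎
      where
      c+a≤m⇔a≤m∸c : c + a ≤ m ⇔ a ≤ m ∸ c
      c+a≤m⇔a≤m∸c = mk⇔ (λ le → ℕₚ.m+n≤o⇒m≤o∸n a (≡.subst (_≤ m) (ℕₚ.+-comm c a) le))
                        (λ le → ≡.subst (_≤ m) (ℕₚ.+-comm a c) (ℕₚ.m≤o∸n⇒m+n≤o a c≤m le))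
      last≡ : last ≡ (if a ≤ᵇ m ∸ c then partsUpTo k (m ∸ c ∸ a) else 0)
      last≡ = ≡.cong₂ (λ b x → if b then partsUpTo k x else 0)
                      (does-⇔ c+a≤m⇔a≤m∸c (c + a N.≤? m) (a N.≤? m ∸ c)) (≡.sym (ℕₚ.∸-+-assoc m c a))
    by-cases (no c≰m) = begin
      P + (if c ≤ᵇ m then G i else 0) + last  ≡⟨ ≡.cong₂ (λ x y → P + x + y) (if-no (c N.≤? m) c≰m)
                                                    (if-no (c + a N.≤? m) (λ le → c≰m (ℕₚ.m+n≤o⇒m≤o c le))) ⟩
      P + 0 + 0                               ≡⟨ ℕₚ.+-identityʳ (P + 0) ⟩
      P + 0                                   ≡⟨ ≡.cong (P +_) (if-no (c N.≤? m) c≰m) ⟨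
      P + (if c ≤ᵇ m then G (suc i) else 0)   ∎

  partsUpTo-suc : ∀ k m →
    partsUpTo (suc k) m ≡ partsUpTo k m + (if suc k ≤ᵇ m then partsUpTo (suc k) (m ∸ suc k) else 0)
  partsUpTo-suc k zero    = ≡.sym (ℕₚ.+-identityʳ _)
  partsUpTo-suc k (suc m) =
    ≡.trans (partsUpTo-go-suc k (suc m) m) (≡.cong (partsUpTo k (suc m) +_) (by-cases (suc k N.≤? suc m)))
    where
    by-cases : Dec (suc k ≤ suc m) →
      (if suc k ≤ᵇ suc m then partsUpTo-go k (suc m ∸ suc k) m else 0) ≡
      (if suc k ≤ᵇ suc m then partsUpTo (suc k) (suc m ∸ suc k) else 0)
    by-cases (yes k<m) = ≡.trans (if-yes (suc k N.≤? suc m) k<m)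
                                 (≡.trans (partsUpTo-go-saturates k (suc m ∸ suc k) m (ℕₚ.m∸n≤m m k))
                                          (≡.sym (if-yes (suc k N.≤? suc m) k<m)))
    by-cases (no k≮m) = ≡.trans (if-no (suc k N.≤? suc m) k≮m) (≡.sym (if-no (suc k N.≤? suc m) k≮m))

  partsUpTo-saturates : ∀ j m → m ≤ j → partsUpTo j m ≡ partition m
  partsUpTo-saturates j m m≤j = ≡.subst (λ j → partsUpTo j m ≡ partition m) (ℕₚ.m∸n+n≡m m≤j) (beyond (j ∸ m))
    where
    beyond : ∀ d → partsUpTo (d + m) m ≡ partition m
    beyond zero    = ≡.refl
    beyond (suc d) = ≡.trans (partsUpTo-suc (d + m) m)
                             (≡.trans (≡.cong (partsUpTo (d + m) m +_)
                                              (if-no (suc (d + m) N.≤? m) (ℕₚ.<⇒≱ (s≤s (ℕₚ.m≤n+m m d)))))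
                                      (≡.trans (ℕₚ.+-identityʳ _) (beyond d)))

open PartitionRecurrence

module ArithmeticFunctions {c ℓ : Level} (R : CommutativeRing c ℓ) where
  open CommutativeRing R hiding (zero)
  open WithRing R
  open import Algebra.Properties.Ring ring using (-0#≈0#; -‿+-comm; xyx⁻¹≈y; -‿distribʳ-*; [y-z]x≈yx-zx)
  open import Algebra.Properties.CommutativeSemigroup +-commutativeSemigroup using (interchange)
  open import Relation.Binary.Reasoning.Setoid setoid

  [x+y]+[z-y]≈x+z : ∀ x y z → (x + y) + (z - y) ≈ x + z
  [x+y]+[z-y]≈x+z x y z = trans (+-assoc x y _) (+-congˡ (trans (sym (+-assoc y z _)) (xyx⁻¹≈y y z)))

  [x+z]-[y+x]≈z-y : ∀ x y z → (x + z) - (y + x) ≈ z - y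
  [x+z]-[y+x]≈z-y x y z = begin
    (x + z) - (y + x)       ≈⟨ +-congˡ (trans (-‿cong (+-comm y x)) (sym (-‿+-comm x y))) ⟩
    (x + z) + (- x + - y)   ≈⟨ interchange x z (- x) (- y) ⟩
    (x - x) + (z - y)       ≈⟨ trans (+-congʳ (-‿inverseʳ x)) (+-identityˡ _) ⟩
    z - y                   ∎

  module _ {p} {P : Set p} where

    if-cong : (d : Dec P) {x y : Carrier} → (P → x ≈ y) → (if does d then x else 0#) ≈ (if does d then y else 0#)
    if-cong (yes p) x≈y = x≈y p
    if-cong (no _)  _   = refl

    if-≈0 : (d : Dec P) {x : Carrier} → (P → x ≈ 0#) → (if does d then x else 0#) ≈ 0#
    if-≈0 (yes p) x≈0 = x≈0 p
    if-≈0 (no _)  _   = refl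

  if-*ʳ : ∀ b (x y : Carrier) → (if b then x else 0#) * y ≈ (if b then x * y else 0#)
  if-*ʳ true  x y = refl
  if-*ʳ false x y = zeroˡ y

  if-*ˡ : ∀ b (x y : Carrier) → y * (if b then x else 0#) ≈ (if b then y * x else 0#)
  if-*ˡ true  x y = refl
  if-*ˡ false x y = zeroʳ y

  if-+ : ∀ b (x y : Carrier) → (if b then x + y else 0#) ≈ (if b then x else 0#) + (if b then y else 0#)
  if-+ true  x y = refl
  if-+ false x y = sym (+-identityˡ 0#)

  if-neg : ∀ b (x : Carrier) → (if b then - x else 0#) ≈ - (if b then x else 0#)
  if-neg true  x = refl
  if-neg false x = sym -0#≈0#

  if-if : ∀ b b′ (x : Carrier) →
    (if b then (if b′ then x else 0#) else 0#) ≡ (if b′ then (if b then x else 0#) else 0#)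
  if-if true  b′    x = ≡.refl
  if-if false true  x = ≡.refl
  if-if false false x = ≡.refl

  sum1-cong : ∀ n {f h : ℕ → Carrier} → (∀ i → 1 ≤ i → i ≤ n → f i ≈ h i) → sum1 n f ≈ sum1 n h
  sum1-cong zero    f≈h = refl
  sum1-cong (suc n) f≈h =
    +-cong (sum1-cong n λ i 1≤i i≤n → f≈h i 1≤i (ℕₚ.m≤n⇒m≤1+n i≤n)) (f≈h (suc n) (s≤s z≤n) ℕₚ.≤-refl)

  sum1-≈0 : ∀ n {f : ℕ → Carrier} → (∀ i → 1 ≤ i → i ≤ n → f i ≈ 0#) → sum1 n f ≈ 0#
  sum1-≈0 n {f} f≈0 = trans (sum1-cong n f≈0) (zeros n)
    where
    zeros : ∀ n → sum1 n (λ _ → 0#) ≈ 0#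
    zeros zero    = refl
    zeros (suc n) = trans (+-identityʳ _) (zeros n)

  sum1-distrib-+ : ∀ n (f h : ℕ → Carrier) → sum1 n (λ i → f i + h i) ≈ sum1 n f + sum1 n h
  sum1-distrib-+ zero    f h = sym (+-identityˡ 0#)
  sum1-distrib-+ (suc n) f h = trans (+-congʳ (sum1-distrib-+ n f h)) (interchange _ _ _ _)

  -‿distrib-sum1 : ∀ n (f : ℕ → Carrier) → - sum1 n f ≈ sum1 n (λ i → - f i)
  -‿distrib-sum1 zero    f = -0#≈0#
  -‿distrib-sum1 (suc n) f = trans (sym (-‿+-comm _ _)) (+-congʳ (-‿distrib-sum1 n f))

  *-distribˡ-sum1 : ∀ n x (f : ℕ → Carrier) → x * sum1 n f ≈ sum1 n (λ i → x * f i)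
  *-distribˡ-sum1 zero    x f = zeroʳ x
  *-distribˡ-sum1 (suc n) x f = trans (distribˡ x _ _) (+-congʳ (*-distribˡ-sum1 n x f))

  *-distribʳ-sum1 : ∀ n x (f : ℕ → Carrier) → sum1 n f * x ≈ sum1 n (λ i → f i * x)
  *-distribʳ-sum1 n x f =
    trans (*-comm _ x) (trans (*-distribˡ-sum1 n x f) (sum1-cong n λ i _ _ → *-comm x (f i)))

  if-sum1 : ∀ b m (f : ℕ → Carrier) → (if b then sum1 m f else 0#) ≈ sum1 m (λ i → if b then f i else 0#)
  if-sum1 true  m f = refl
  if-sum1 false m f = sym (sum1-≈0 m λ _ _ _ → refl)

  sum1-comm : ∀ n m (f : ℕ → ℕ → Carrier) →
    sum1 n (λ a → sum1 m (λ b → f a b)) ≈ sum1 m (λ b → sum1 n (λ a → f a b))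
  sum1-comm zero    m f = sym (sum1-≈0 m λ _ _ _ → refl)
  sum1-comm (suc n) m f = trans (+-congʳ (sum1-comm n m f)) (sym (sum1-distrib-+ m _ _))

  sum1-vanishing-tail : ∀ m n {f : ℕ → Carrier} → m ≤ n → (∀ i → m < i → i ≤ n → f i ≈ 0#) → sum1 n f ≈ sum1 m f
  sum1-vanishing-tail m zero    z≤n _ = refl
  sum1-vanishing-tail m (suc n) m≤n f≈0 with ℕₚ.m≤n⇒m<n∨m≡n m≤n
  ... | inj₂ ≡.refl     = refl
  ... | inj₁ (s≤s m≤n′) = trans (+-cong (sum1-vanishing-tail m n m≤n′ λ i m<i i≤n → f≈0 i m<i (ℕₚ.m≤n⇒m≤1+n i≤n))
                                        (f≈0 (suc n) (s≤s m≤n′) ℕₚ.≤-refl))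
                                (+-identityʳ _)

  sum1-single : ∀ n j {f : ℕ → Carrier} → 1 ≤ j → j ≤ n → (∀ i → 1 ≤ i → i ≤ n → ¬ i ≡ j → f i ≈ 0#) →
                sum1 n f ≈ f j
  sum1-single zero    (suc _) _ () _
  sum1-single (suc n) j 1≤j j≤n f≈0 with ℕₚ.m≤n⇒m<n∨m≡n j≤n
  ... | inj₂ ≡.refl = trans (+-congʳ (sum1-≈0 n λ i 1≤i i≤n →
                              f≈0 i 1≤i (ℕₚ.m≤n⇒m≤1+n i≤n) λ { ≡.refl → ℕₚ.<-irrefl ≡.refl (s≤s i≤n) }))
                            (+-identityˡ _)
  ... | inj₁ (s≤s j≤n′) = trans (+-cong (sum1-single n j 1≤j j≤n′ λ i 1≤i i≤n → f≈0 i 1≤i (ℕₚ.m≤n⇒m≤1+n i≤n))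
                                        (f≈0 (suc n) (s≤s z≤n) ℕₚ.≤-refl λ { ≡.refl → ℕₚ.<-irrefl ≡.refl (s≤s j≤n′) }))
                                (+-identityʳ _)

  sum1-truncate : ∀ l n (F : ℕ → Carrier) → l ≤ n → sum1 n (λ r → if r ≤ᵇ l then F r else 0#) ≈ sum1 l F
  sum1-truncate l n F l≤n = trans (sum1-vanishing-tail l n l≤n λ r l<r _ → reflexive (if-no (r N.≤? l) (ℕₚ.<⇒≱ l<r)))
                                  (sum1-cong l λ r _ r≤l → reflexive (if-yes (r N.≤? l) r≤l))

  sum1-vanishing-tails : ∀ a b {f : ℕ → Carrier} → (∀ i → a < i → f i ≈ 0#) → (∀ i → b < i → f i ≈ 0#) →
                         sum1 a f ≈ sum1 b f
  sum1-vanishing-tails a b f≈0₁ f≈0₂ with ℕₚ.≤-total a b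
  ... | inj₁ a≤b = sym (sum1-vanishing-tail a b a≤b λ i a<i _ → f≈0₁ i a<i)
  ... | inj₂ b≤a = sum1-vanishing-tail b a b≤a λ i b<i _ → f≈0₂ i b<i

  sum1-indicator : ∀ N x (Y : ℕ → Carrier) → 1 ≤ x →
                   sum1 N (λ d → if x ≡ᵇ d then Y d else 0#) ≈ (if x ≤ᵇ N then Y x else 0#)
  sum1-indicator N x Y 1≤x with x N.≤? N
  ... | yes x≤N = trans (sum1-single N x 1≤x x≤N λ d _ _ d≢x → reflexive (if-no (x N.≟ d) λ x≡d → d≢x (≡.sym x≡d)))
                        (reflexive (≡.trans (if-yes (x N.≟ x) ≡.refl) (≡.sym (if-yes (x N.≤? N) x≤N))))
  ... | no x≰N = trans (sum1-≈0 N λ d _ d≤N → reflexive (if-no (x N.≟ d) λ { ≡.refl → x≰N d≤N }))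
                       (reflexive (≡.sym (if-no (x N.≤? N) x≰N)))

  sum1-indicator-vanishing : ∀ N x (Y : ℕ → Carrier) → 1 ≤ x → (N < x → Y x ≈ 0#) →
                             sum1 N (λ d → if x ≡ᵇ d then Y d else 0#) ≈ Y x
  sum1-indicator-vanishing N x Y 1≤x Y≈0 = trans (sum1-indicator N x Y 1≤x) (by-cases (x N.≤? N))
    where
    by-cases : Dec (x ≤ N) → (if x ≤ᵇ N then Y x else 0#) ≈ Y x
    by-cases (yes x≤N) = reflexive (if-yes (x N.≤? N) x≤N)
    by-cases (no x≰N)  = trans (reflexive (if-no (x N.≤? N) x≰N)) (sym (Y≈0 (ℕₚ.≰⇒> x≰N)))

  divisorPairSum : ℕ → ℕ → (ℕ → ℕ → Carrier) → Carrier
  divisorPairSum m n F = sum1 m (λ a → sum1 m (λ b → if a N.* b ≡ᵇ n then F a b else 0#))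

  divisorPairSum-cong : ∀ m n {F G : ℕ → ℕ → Carrier} → (∀ a b → 1 ≤ a → 1 ≤ b → a N.* b ≡ n → F a b ≈ G a b) →
                        divisorPairSum m n F ≈ divisorPairSum m n G
  divisorPairSum-cong m n F≈G =
    sum1-cong m λ a 1≤a _ → sum1-cong m λ b 1≤b _ → if-cong (a N.* b N.≟ n) (F≈G a b 1≤a 1≤b)

  divisorPairSum-bound : ∀ m m′ n F → 1 ≤ n → n ≤ m → m ≤ m′ → divisorPairSum m′ n F ≈ divisorPairSum m n F
  divisorPairSum-bound m m′ n F 1≤n n≤m m≤m′ =
    trans (sum1-cong m′ λ a 1≤a _ → sum1-vanishing-tail m m′ m≤m′ λ b m<b _ →
             reflexive (if-no (a N.* b N.≟ n) λ ab≡n → ℕₚ.<⇒≱ (ℕₚ.≤-<-trans n≤m m<b) (*≡⇒≤ʳ 1≤a ab≡n)))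
          (sum1-vanishing-tail m m′ m≤m′ λ a m<a _ → sum1-≈0 m λ b 1≤b _ →
             reflexive (if-no (a N.* b N.≟ n) λ ab≡n → ℕₚ.<⇒≱ (ℕₚ.≤-<-trans n≤m m<a) (*≡⇒≤ˡ 1≤b ab≡n)))

  sum1-quotient : ∀ i n (F : ℕ → Carrier) → 1 ≤ n →
    sum1 n (λ b → if suc i N.* b ≡ᵇ n then F b else 0#) ≈ (if does (suc i ∣? n) then F (n / suc i) else 0#)
  sum1-quotient i n F 1≤n = by-cases (suc i ∣? n)
    where
    by-cases : Dec (suc i ∣ n) →
      sum1 n (λ b → if suc i N.* b ≡ᵇ n then F b else 0#) ≈ (if does (suc i ∣? n) then F (n / suc i) else 0#)
    by-cases (yes i∣n@(divides q n≡qi)) = begin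
      sum1 n (λ b → if suc i N.* b ≡ᵇ n then F b else 0#)
        ≈⟨ sum1-single n q (*≡⇒1≤ˡ 1≤n (≡.sym n≡qi)) (*≡⇒≤ˡ (s≤s z≤n) (≡.sym n≡qi)) (λ b _ _ b≢q →
             reflexive (if-no (suc i N.* b N.≟ n) λ ib≡n → b≢q (ℕₚ.*-cancelˡ-≡ b q (suc i) (≡.trans ib≡n n≡iq)))) ⟩
      (if suc i N.* q ≡ᵇ n then F q else 0#)
        ≡⟨ if-yes (suc i N.* q N.≟ n) (≡.sym n≡iq) ⟩
      F q
        ≡⟨ ≡.cong F (≡.trans (≡.cong (_/ suc i) n≡qi) (m*n/n≡m q (suc i))) ⟨
      F (n / suc i)
        ≡⟨ if-yes (suc i ∣? n) i∣n ⟨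
      (if does (suc i ∣? n) then F (n / suc i) else 0#) ∎
      where
      n≡iq : n ≡ suc i N.* q
      n≡iq = ≡.trans n≡qi (ℕₚ.*-comm q (suc i))
    by-cases (no i∤n) = trans (sum1-≈0 n λ b _ _ → reflexive (if-no (suc i N.* b N.≟ n) λ ib≡n →
                                 i∤n (divides b (≡.trans (≡.sym ib≡n) (ℕₚ.*-comm (suc i) b)))))
                              (reflexive (≡.sym (if-no (suc i ∣? n) i∤n)))

  ⋆≈divisorPairSum : ∀ f h n → 1 ≤ n → (f ⋆ h) n ≈ divisorPairSum n n (λ a b → f a * h b)
  ⋆≈divisorPairSum f h n 1≤n = sum1-cong n λ where
    (suc i) _ _ → sym (begin
      sum1 n (λ b → if suc i N.* b ≡ᵇ n then f (suc i) * h b else 0#)  ≈⟨ sum1-cong n (λ b _ _ → if-*ˡ (suc i N.* b ≡ᵇ n) _ _) ⟨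
      sum1 n (λ b → f (suc i) * (if suc i N.* b ≡ᵇ n then h b else 0#)) ≈⟨ *-distribˡ-sum1 n (f (suc i)) _ ⟨
      f (suc i) * sum1 n (λ b → if suc i N.* b ≡ᵇ n then h b else 0#)   ≈⟨ *-congˡ (sum1-quotient i n h 1≤n) ⟩
      f (suc i) * (if does (suc i ∣? n) then h (n / suc i) else 0#)      ≈⟨ if-*ˡ (does (suc i ∣? n)) _ _ ⟩
      (if does (suc i ∣? n) then f (suc i) * h (n / suc i) else 0#)      ∎)

  -- Arithmetic functions are compared on n ≥ 1 only; their values at 0 are junk.
  infix 4 _≋_
  _≋_ : (ℕ → Carrier) → (ℕ → Carrier) → Set ℓ
  f ≋ h = ∀ n → 1 ≤ n → f n ≈ h n

  ≋-trans : ∀ {f h k} → f ≋ h → h ≋ k → f ≋ k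
  ≋-trans f≋h h≋k n 1≤n = trans (f≋h n 1≤n) (h≋k n 1≤n)

  infixl 6 _⊕_ _⊖_
  _⊕_ _⊖_ : (ℕ → Carrier) → (ℕ → Carrier) → ℕ → Carrier
  (f ⊕ h) n = f n + h n
  (f ⊖ h) n = f n - h n

  δ₁ 𝟙 : ℕ → Carrier
  δ₁ n = δ n 1
  𝟙 _  = 1#

  ⋆-cong-divisors : ∀ n {f f′ h h′} → 1 ≤ n →
    (∀ a b → 1 ≤ a → 1 ≤ b → a N.* b ≡ n → f a * h b ≈ f′ a * h′ b) → (f ⋆ h) n ≈ (f′ ⋆ h′) n
  ⋆-cong-divisors n {f} {f′} {h} {h′} 1≤n fh≈ = begin
    (f ⋆ h) n                                 ≈⟨ ⋆≈divisorPairSum f h n 1≤n ⟩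
    divisorPairSum n n (λ a b → f a * h b)   ≈⟨ divisorPairSum-cong n n fh≈ ⟩
    divisorPairSum n n (λ a b → f′ a * h′ b) ≈⟨ ⋆≈divisorPairSum f′ h′ n 1≤n ⟨
    (f′ ⋆ h′) n                               ∎

  ⋆-≈0-divisors : ∀ n {f h} → 1 ≤ n → (∀ a b → 1 ≤ a → 1 ≤ b → a N.* b ≡ n → f a * h b ≈ 0#) → (f ⋆ h) n ≈ 0#
  ⋆-≈0-divisors n {f} {h} 1≤n fh≈0 = trans (⋆≈divisorPairSum f h n 1≤n) (sum1-≈0 n λ a 1≤a _ → sum1-≈0 n λ b 1≤b _ →
    if-≈0 (a N.* b N.≟ n) (fh≈0 a b 1≤a 1≤b))

  ⋆-cong : ∀ {f f′ h h′} → f ≋ f′ → h ≋ h′ → f ⋆ h ≋ f′ ⋆ h′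
  ⋆-cong f≋f′ h≋h′ n 1≤n = ⋆-cong-divisors n 1≤n λ a b 1≤a 1≤b _ → *-cong (f≋f′ a 1≤a) (h≋h′ b 1≤b)

  ⋆-congˡ : ∀ {f h h′} → h ≋ h′ → f ⋆ h ≋ f ⋆ h′
  ⋆-congˡ = ⋆-cong λ _ _ → refl

  ⋆-congʳ : ∀ {f f′ h} → f ≋ f′ → f ⋆ h ≋ f′ ⋆ h
  ⋆-congʳ f≋f′ = ⋆-cong f≋f′ λ _ _ → refl

  ⋆-comm : ∀ f h → f ⋆ h ≋ h ⋆ f
  ⋆-comm f h n 1≤n = begin
    (f ⋆ h) n
      ≈⟨ ⋆≈divisorPairSum f h n 1≤n ⟩
    sum1 n (λ a → sum1 n (λ b → if a N.* b ≡ᵇ n then f a * h b else 0#))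
      ≈⟨ sum1-comm n n _ ⟩
    sum1 n (λ b → sum1 n (λ a → if a N.* b ≡ᵇ n then f a * h b else 0#))
      ≈⟨ sum1-cong n (λ b _ _ → sum1-cong n λ a _ _ →
           reflexive (≡.cong (λ x → if x ≡ᵇ n then f a * h b else 0#) (ℕₚ.*-comm a b))) ⟩
    sum1 n (λ b → sum1 n (λ a → if b N.* a ≡ᵇ n then f a * h b else 0#))
      ≈⟨ divisorPairSum-cong n n (λ b a _ _ _ → *-comm (f a) (h b)) ⟩
    divisorPairSum n n (λ b a → h b * f a)
      ≈⟨ ⋆≈divisorPairSum h f n 1≤n ⟨
    (h ⋆ f) n ∎

  ⋆-identityˡ : ∀ f → δ₁ ⋆ f ≋ f
  ⋆-identityˡ f n 1≤n = begin
    (δ₁ ⋆ f) n                                      ≈⟨ sum1-single n 1 (s≤s z≤n) 1≤n (λ where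
                                                         (suc zero) _ _ 1≢1 → ⊥-elim (1≢1 ≡.refl)
                                                         (suc (suc i)) _ _ _ → if-≈0 (2 N.+ i ∣? n) λ _ → zeroˡ _) ⟩
    (if does (1 ∣? n) then 1# * f (n / 1) else 0#)  ≡⟨ if-yes (1 ∣? n) (divides n (≡.sym (ℕₚ.*-identityʳ n))) ⟩
    1# * f (n / 1)                                  ≈⟨ *-identityˡ _ ⟩
    f (n / 1)                                       ≡⟨ ≡.cong f (n/1≡n n) ⟩
    f n                                             ∎

  ⋆-identityʳ : ∀ f → f ⋆ δ₁ ≋ f
  ⋆-identityʳ f = ≋-trans (⋆-comm f δ₁) (⋆-identityˡ f)

  ⋆-distribˡ-⊕ : ∀ f h k → f ⋆ (h ⊕ k) ≋ (f ⋆ h) ⊕ (f ⋆ k)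
  ⋆-distribˡ-⊕ f h k n _ = trans (sum1-cong n λ where
                                   (suc i) _ _ → trans (if-cong (suc i ∣? n) λ _ → distribˡ _ _ _)
                                                       (if-+ (does (suc i ∣? n)) _ _))
                                 (sum1-distrib-+ n _ _)

  ⋆-neg : ∀ f h → f ⋆ (λ x → - h x) ≋ (λ x → - (f ⋆ h) x)
  ⋆-neg f h n _ = trans (sum1-cong n λ where
                           (suc i) _ _ → trans (if-cong (suc i ∣? n) λ _ → sym (-‿distribʳ-* _ _))
                                               (if-neg (does (suc i ∣? n)) _))
                        (sym (-‿distrib-sum1 n _))

  ⋆-distribˡ-⊖ : ∀ f h k → f ⋆ (h ⊖ k) ≋ (f ⋆ h) ⊖ (f ⋆ k)
  ⋆-distribˡ-⊖ f h k n 1≤n = trans (⋆-distribˡ-⊕ f h (λ x → - k x) n 1≤n) (+-congˡ (⋆-neg f k n 1≤n))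

  ⋆-distrib-sum1 : ∀ f N (F : ℕ → ℕ → Carrier) →
                   f ⋆ (λ x → sum1 N (λ j → F j x)) ≋ (λ x → sum1 N (λ j → (f ⋆ F j) x))
  ⋆-distrib-sum1 f N F n _ = trans (sum1-cong n λ where
                                     (suc i) _ _ → trans (if-cong (suc i ∣? n) λ _ → *-distribˡ-sum1 N _ _)
                                                         (if-sum1 (does (suc i ∣? n)) N _))
                                   (sum1-comm n N _)

  ⋆-distribʳ-⊕ : ∀ f h k → (h ⊕ k) ⋆ f ≋ (h ⋆ f) ⊕ (k ⋆ f)
  ⋆-distribʳ-⊕ f h k n 1≤n = trans (⋆-comm (h ⊕ k) f n 1≤n)
    (trans (⋆-distribˡ-⊕ f h k n 1≤n) (+-cong (⋆-comm f h n 1≤n) (⋆-comm f k n 1≤n)))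

  ⋆-distribʳ-⊖ : ∀ f h k → (h ⊖ k) ⋆ f ≋ (h ⋆ f) ⊖ (k ⋆ f)
  ⋆-distribʳ-⊖ f h k n 1≤n = trans (⋆-comm (h ⊖ k) f n 1≤n)
    (trans (⋆-distribˡ-⊖ f h k n 1≤n) (+-cong (⋆-comm f h n 1≤n) (-‿cong (⋆-comm f k n 1≤n))))

  sum1-distrib-⋆ : ∀ f N (F : ℕ → ℕ → Carrier) →
                   (λ x → sum1 N (λ j → F j x)) ⋆ f ≋ (λ x → sum1 N (λ j → (F j ⋆ f) x))
  sum1-distrib-⋆ f N F n 1≤n = trans (⋆-comm _ f n 1≤n)
    (trans (⋆-distrib-sum1 f N F n 1≤n) (sum1-cong N λ j _ _ → ⋆-comm f (F j) n 1≤n))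

  divisorTripleSum : ℕ → ℕ → (ℕ → ℕ → ℕ → Carrier) → Carrier
  divisorTripleSum N n F =
    sum1 N λ a → sum1 N λ b → sum1 N λ c → if a N.* (b N.* c) ≡ᵇ n then F a b c else 0#

  ⋆-⋆≈divisorTripleSum : ∀ f g h N n → 1 ≤ n → n ≤ N →
    (f ⋆ (g ⋆ h)) n ≈ divisorTripleSum N n (λ a b c → f a * (g b * h c))
  ⋆-⋆≈divisorTripleSum f g h N n 1≤n n≤N = begin
    (f ⋆ (g ⋆ h)) n
      ≈⟨ ⋆≈divisorPairSum f (g ⋆ h) n 1≤n ⟩
    divisorPairSum n n (λ a d → f a * (g ⋆ h) d)
      ≈⟨ divisorPairSum-bound n N n _ 1≤n ℕₚ.≤-refl n≤N ⟨
    divisorPairSum N n (λ a d → f a * (g ⋆ h) d)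
      ≈⟨ sum1-cong N (λ a 1≤a _ → sum1-cong N λ d _ _ → expand a d 1≤a) ⟩
    sum1 N (λ a → sum1 N λ d → sum1 N λ b → sum1 N λ c → Z a b c d)
      ≈⟨ sum1-cong N (λ a _ _ → trans (sum1-comm N N _) (sum1-cong N λ b _ _ → sum1-comm N N _)) ⟩
    sum1 N (λ a → sum1 N λ b → sum1 N λ c → sum1 N λ d → Z a b c d)
      ≈⟨ sum1-cong N (λ a 1≤a _ → sum1-cong N λ b 1≤b _ → sum1-cong N λ c 1≤c _ →
           sum1-indicator-vanishing N (b N.* c) _ (ℕₚ.*-mono-≤ 1≤b 1≤c) λ N<bc →
             reflexive (if-no (a N.* (b N.* c) N.≟ n) λ abc≡n → ℕₚ.<⇒≱ (ℕₚ.≤-<-trans n≤N N<bc) (*≡⇒≤ʳ 1≤a abc≡n))) ⟩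
    divisorTripleSum N n (λ a b c → f a * (g b * h c)) ∎
    where
    Z : ℕ → ℕ → ℕ → ℕ → Carrier
    Z a b c d = if b N.* c ≡ᵇ d then (if a N.* d ≡ᵇ n then f a * (g b * h c) else 0#) else 0#
    expand : ∀ a d → 1 ≤ a → (if a N.* d ≡ᵇ n then f a * (g ⋆ h) d else 0#) ≈ sum1 N (λ b → sum1 N λ c → Z a b c d)
    expand a d 1≤a = begin
      (if a N.* d ≡ᵇ n then f a * (g ⋆ h) d else 0#)
        ≈⟨ if-cong (a N.* d N.≟ n) (λ ad≡n → *-congˡ (trans (⋆≈divisorPairSum g h d (*≡⇒1≤ʳ {a} 1≤n ad≡n))
                                                        (sym (divisorPairSum-bound d N d _ (*≡⇒1≤ʳ {a} 1≤n ad≡n) ℕₚ.≤-refl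
                                                                (ℕₚ.≤-trans (*≡⇒≤ʳ 1≤a ad≡n) n≤N))))) ⟩
      (if a N.* d ≡ᵇ n then f a * divisorPairSum N d (λ b c → g b * h c) else 0#)
        ≈⟨ if-cong (a N.* d N.≟ n) (λ _ → trans (*-distribˡ-sum1 N _ _) (sum1-cong N λ b _ _ →
             trans (*-distribˡ-sum1 N _ _) (sum1-cong N λ c _ _ → if-*ˡ (b N.* c ≡ᵇ d) _ _))) ⟩
      (if a N.* d ≡ᵇ n then sum1 N (λ b → sum1 N λ c → if b N.* c ≡ᵇ d then f a * (g b * h c) else 0#) else 0#)
        ≈⟨ trans (if-sum1 (a N.* d ≡ᵇ n) N _) (sum1-cong N λ b _ _ →
             trans (if-sum1 (a N.* d ≡ᵇ n) N _) (sum1-cong N λ c _ _ → reflexive (if-if (a N.* d ≡ᵇ n) (b N.* c ≡ᵇ d) _))) ⟩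
      sum1 N (λ b → sum1 N λ c → Z a b c d) ∎

  ⋆-assoc : ∀ f g h → (f ⋆ g) ⋆ h ≋ f ⋆ (g ⋆ h)
  ⋆-assoc f g h n 1≤n = begin
    ((f ⋆ g) ⋆ h) n                                       ≈⟨ ⋆-comm (f ⋆ g) h n 1≤n ⟩
    (h ⋆ (f ⋆ g)) n                                       ≈⟨ ⋆-⋆≈divisorTripleSum h f g n n 1≤n ℕₚ.≤-refl ⟩
    divisorTripleSum n n (λ c a b → h c * (f a * g b))
      ≈⟨ trans (sum1-comm n n _) (sum1-cong n λ a _ _ → sum1-comm n n _) ⟩
    sum1 n (λ a → sum1 n λ b → sum1 n λ c → if c N.* (a N.* b) ≡ᵇ n then h c * (f a * g b) else 0#)
      ≈⟨ sum1-cong n (λ a _ _ → sum1-cong n λ b _ _ → sum1-cong n λ c _ _ →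
           trans (reflexive (≡.cong (λ x → if x ≡ᵇ n then h c * (f a * g b) else 0#) (rotate c a b)))
                 (if-cong (a N.* (b N.* c) N.≟ n) λ _ → trans (*-comm _ _) (*-assoc _ _ _))) ⟩
    divisorTripleSum n n (λ a b c → f a * (g b * h c))    ≈⟨ ⋆-⋆≈divisorTripleSum f g h n n 1≤n ℕₚ.≤-refl ⟨
    (f ⋆ (g ⋆ h)) n                                       ∎
    where
    rotate : ∀ c a b → c N.* (a N.* b) ≡ a N.* (b N.* c)
    rotate c a b = ≡.trans (ℕₚ.*-comm c (a N.* b)) (ℕₚ.*-assoc a b c)

  μ-prime-*-coprime : ∀ {p} → Prime p → ∀ e → ¬ p ∣ suc e → μ (p N.* suc e) ≈ - μ (suc e)
  μ-prime-*-coprime {p} pr e p∤e = begin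
    μ (p N.* suc e)
      ≡⟨ ≡.cong₂ (λ b k → if b then negOnePow k else 0#)
                 (≡.trans (squarefree-prime-* pr e) (if-no (p ∣? suc e) p∤e)) (Ω-prime-* pr e) ⟩
    (if squarefree (suc e) then - negOnePow (Ω (suc e)) else 0#)
      ≈⟨ if-neg (squarefree (suc e)) _ ⟩
    - μ (suc e) ∎

  μ-prime-*-dvd : ∀ {p} → Prime p → ∀ e → p ∣ suc e → μ (p N.* suc e) ≈ 0#
  μ-prime-*-dvd {p} pr e p∣e = reflexive (≡.cong (λ b → if b then negOnePow (Ω (p N.* suc e)) else 0#)
                                                 (≡.trans (squarefree-prime-* pr e) (if-yes (p ∣? suc e) p∣e)))

  sum1-multiples : ∀ n p (F : ℕ → Carrier) → 1 ≤ p → (∀ x → n < x → F x ≈ 0#) →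
    sum1 n (λ d → if does (p ∣? d) then F d else 0#) ≈ sum1 n (λ e → F (p N.* e))
  sum1-multiples n p F 1≤p F≈0 = begin
    sum1 n (λ d → if does (p ∣? d) then F d else 0#)
      ≈⟨ sum1-cong n (λ d 1≤d d≤n → quotients d 1≤d d≤n (p ∣? d)) ⟨
    sum1 n (λ d → sum1 n (λ e → if p N.* e ≡ᵇ d then F d else 0#))
      ≈⟨ sum1-comm n n _ ⟩
    sum1 n (λ e → sum1 n (λ d → if p N.* e ≡ᵇ d then F d else 0#))
      ≈⟨ sum1-cong n (λ e 1≤e _ → sum1-indicator-vanishing n (p N.* e) F (ℕₚ.*-mono-≤ 1≤p 1≤e) (F≈0 (p N.* e))) ⟩
    sum1 n (λ e → F (p N.* e)) ∎
    where
    instance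
      p≢0 : NonZero p
      p≢0 = N.>-nonZero 1≤p
    quotients : ∀ d → 1 ≤ d → d ≤ n → Dec (p ∣ d) →
      sum1 n (λ e → if p N.* e ≡ᵇ d then F d else 0#) ≈ (if does (p ∣? d) then F d else 0#)
    quotients d 1≤d d≤n (yes p∣d@(divides q d≡qp)) =
      trans (sum1-single n q (*≡⇒1≤ˡ 1≤d (≡.sym d≡qp)) (ℕₚ.≤-trans (*≡⇒≤ˡ 1≤p (≡.sym d≡qp)) d≤n) λ e _ _ e≢q →
               reflexive (if-no (p N.* e N.≟ d) λ pe≡d →
                 e≢q (ℕₚ.*-cancelˡ-≡ e q p (≡.trans pe≡d (≡.trans d≡qp (ℕₚ.*-comm q p))))))
            (reflexive (≡.trans (if-yes (p N.* q N.≟ d) (≡.trans (ℕₚ.*-comm p q) (≡.sym d≡qp)))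
                                (≡.sym (if-yes (p ∣? d) p∣d))))
    quotients d _ _ (no p∤d) =
      trans (sum1-≈0 n λ e _ _ → reflexive (if-no (p N.* e N.≟ d) λ pe≡d →
               p∤d (divides e (≡.trans (≡.sym pe≡d) (ℕₚ.*-comm p e)))))
            (reflexive (≡.sym (if-no (p ∣? d) p∤d)))

  if-split : ∀ b b′ (x : Carrier) →
    (if b then x else 0#) ≈ (if b then (if b′ then 0# else x) else 0#) + (if b then (if b′ then x else 0#) else 0#)
  if-split true  true  x = sym (+-identityˡ x)
  if-split true  false x = sym (+-identityʳ x)
  if-split false _     x = sym (+-identityˡ 0#)

  divSum-μ : ∀ n → 1 ≤ n → divSum n μ ≈ δ₁ n
  divSum-μ (suc zero)      _ = +-identityˡ _
  divSum-μ n@(suc (suc _)) _ with prime-divisor n (s≤s (s≤s z≤n))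
  ... | p , pr , p∣n = begin
    sum1 n (λ d → if does (d ∣? n) then μ d else 0#)
      ≈⟨ trans (sum1-cong n λ d _ _ → if-split (does (d ∣? n)) (does (p ∣? d)) (μ d)) (sum1-distrib-+ n _ _) ⟩
    sum1 n A + sum1 n (λ d → if does (d ∣? n) then (if does (p ∣? d) then μ d else 0#) else 0#)
      ≈⟨ +-congˡ (sum1-cong n λ d _ _ → reflexive (if-if (does (d ∣? n)) (does (p ∣? d)) (μ d))) ⟩
    sum1 n A + sum1 n (λ d → if does (p ∣? d) then B d else 0#)
      ≈⟨ +-congˡ (sum1-multiples n p B 1≤p λ x n<x → reflexive (if-no (x ∣? n) λ x∣n → ℕₚ.<⇒≱ n<x (∣⇒≤ x∣n))) ⟩
    sum1 n A + sum1 n (λ e → B (p N.* e))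
      ≈⟨ +-congˡ (sum1-cong n λ { (suc e) _ _ → multiple e (p ∣? suc e) (suc e ∣? n) }) ⟩
    sum1 n A + sum1 n (λ e → - A e)
      ≈⟨ +-congˡ (sym (-‿distrib-sum1 n A)) ⟩
    sum1 n A - sum1 n A
      ≈⟨ -‿inverseʳ _ ⟩
    0# ∎
    where
    1≤p : 1 ≤ p
    1≤p = N.>-nonZero⁻¹ p {{prime⇒nonZero pr}}
    A B : ℕ → Carrier
    A d = if does (d ∣? n) then (if does (p ∣? d) then 0# else μ d) else 0#
    B d = if does (d ∣? n) then μ d else 0#
    multiple : ∀ e → Dec (p ∣ suc e) → Dec (suc e ∣ n) → B (p N.* suc e) ≈ - A (suc e)
    multiple e (yes p∣e) _ =
      trans (if-≈0 (p N.* suc e ∣? n) λ _ → μ-prime-*-dvd pr e p∣e)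
            (sym (trans (-‿cong (if-≈0 (suc e ∣? n) λ _ → reflexive (if-yes (p ∣? suc e) p∣e))) -0#≈0#))
    multiple e (no p∤e) (yes e∣n) =
      trans (reflexive (if-yes (p N.* suc e ∣? n) (prime*∣ pr p∣n p∤e e∣n)))
            (trans (μ-prime-*-coprime pr e p∤e)
                   (-‿cong (reflexive (≡.sym (≡.trans (if-yes (suc e ∣? n) e∣n) (if-no (p ∣? suc e) p∤e))))))
    multiple e (no p∤e) (no e∤n) =
      trans (reflexive (if-no (p N.* suc e ∣? n) λ pe∣n → e∤n (∣-trans (n∣m*n p) pe∣n)))
            (sym (trans (-‿cong (reflexive (if-no (suc e ∣? n) e∤n))) -0#≈0#))

  divSum≈⋆𝟙 : ∀ f n → divSum n f ≈ (f ⋆ 𝟙) n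
  divSum≈⋆𝟙 f n = sum1-cong n λ where
    (suc i) _ _ → if-cong (suc i ∣? n) λ _ → sym (*-identityʳ _)

  𝟙⋆μ≋δ₁ : 𝟙 ⋆ μ ≋ δ₁
  𝟙⋆μ≋δ₁ n 1≤n = trans (⋆-comm 𝟙 μ n 1≤n) (trans (sym (divSum≈⋆𝟙 μ n)) (divSum-μ n 1≤n))

  möbius-inversion : ∀ f → (f ⋆ 𝟙) ⋆ μ ≋ f
  möbius-inversion f n 1≤n = begin
    ((f ⋆ 𝟙) ⋆ μ) n  ≈⟨ ⋆-assoc f 𝟙 μ n 1≤n ⟩
    (f ⋆ (𝟙 ⋆ μ)) n  ≈⟨ ⋆-congˡ 𝟙⋆μ≋δ₁ n 1≤n ⟩
    (f ⋆ δ₁) n       ≈⟨ ⋆-identityʳ f n 1≤n ⟩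
    f n              ∎

  ι-+ : ∀ a b → ι (a N.+ b) ≈ ι a + ι b
  ι-+ zero    b = sym (+-identityˡ _)
  ι-+ (suc a) b = trans (+-congˡ (ι-+ a b)) (sym (+-assoc _ _ _))

  ι-if : ∀ b x → ι (if b then x else 0) ≡ (if b then ι x else 0#)
  ι-if true  x = ≡.refl
  ι-if false x = ≡.refl

  sum0 : ℕ → (ℕ → Carrier) → Carrier
  sum0 N f = f 0 + sum1 N f

  sum0-cong : ∀ N {f h : ℕ → Carrier} → (∀ b → b ≤ N → f b ≈ h b) → sum0 N f ≈ sum0 N h
  sum0-cong N f≈h = +-cong (f≈h 0 z≤n) (sum1-cong N λ b _ b≤N → f≈h b b≤N)

  sum0-≈0 : ∀ N {f : ℕ → Carrier} → (∀ b → b ≤ N → f b ≈ 0#) → sum0 N f ≈ 0#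
  sum0-≈0 N f≈0 = trans (+-cong (f≈0 0 z≤n) (sum1-≈0 N λ b _ b≤N → f≈0 b b≤N)) (+-identityʳ 0#)

  sum0-distrib-+ : ∀ N (f h : ℕ → Carrier) → sum0 N (λ b → f b + h b) ≈ sum0 N f + sum0 N h
  sum0-distrib-+ N f h = trans (+-congˡ (sum1-distrib-+ N f h)) (interchange _ _ _ _)

  -‿distrib-sum0 : ∀ N (f : ℕ → Carrier) → - sum0 N f ≈ sum0 N (λ b → - f b)
  -‿distrib-sum0 N f = trans (sym (-‿+-comm _ _)) (+-congˡ (-‿distrib-sum1 N f))

  sum0-vanishing-tail : ∀ M N {f : ℕ → Carrier} → M ≤ N → (∀ b → M < b → b ≤ N → f b ≈ 0#) → sum0 N f ≈ sum0 M f
  sum0-vanishing-tail M N M≤N f≈0 = +-congˡ (sum1-vanishing-tail M N M≤N f≈0)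

  sum0-shift : ∀ j N (H : ℕ → Carrier) → suc j ≤ N →
    sum0 N (λ b → if suc j ≤ᵇ b then H b else 0#) ≈ sum0 (N ∸ suc j) (λ b → H (b N.+ suc j))
  sum0-shift j N H d≤N =
    ≡.subst (λ N′ → sum0 N′ G ≈ sum0 (N ∸ d) (λ b → H (b N.+ d))) (ℕₚ.m∸n+n≡m d≤N) (shifted (N ∸ d))
    where
    d : ℕ
    d = suc j
    G : ℕ → Carrier
    G b = if d ≤ᵇ b then H b else 0#
    shifted : ∀ M → sum0 (M N.+ d) G ≈ sum0 M (λ b → H (b N.+ d))
    shifted zero = begin
      0# + (sum1 j G + G d) ≈⟨ +-identityˡ _ ⟩
      sum1 j G + G d        ≈⟨ +-cong (sum1-≈0 j λ b _ b≤j → reflexive (if-no (d N.≤? b) (ℕₚ.<⇒≱ (s≤s b≤j))))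
                                      (reflexive (if-yes (d N.≤? d) ℕₚ.≤-refl)) ⟩
      0# + H d              ≈⟨ +-comm _ _ ⟩
      H d + 0#              ∎
    shifted (suc M) = trans (sym (+-assoc _ _ _))
      (trans (+-cong (shifted M) (reflexive (if-yes (d N.≤? suc (M N.+ d)) (ℕₚ.m≤n⇒m≤1+n (ℕₚ.m≤n+m d M)))))
             (+-assoc _ _ _))

  -- A factor q^(suc j) of a Cauchy product may be attached to either factor.
  sum0-shift-factor : ∀ j N (E F : ℕ → Carrier) →
    sum0 N (λ b → if suc j ≤ᵇ N ∸ b then E b * F (N ∸ b ∸ suc j) else 0#) ≈
    sum0 N (λ b → if suc j ≤ᵇ b then E (b ∸ suc j) * F (N ∸ b) else 0#)
  sum0-shift-factor j N E F with suc j N.≤? N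
  ... | yes d≤N = begin
    sum0 N (λ b → if d ≤ᵇ N ∸ b then E b * F (N ∸ b ∸ d) else 0#)
      ≈⟨ sum0-vanishing-tail (N ∸ d) N (ℕₚ.m∸n≤m N d) (λ b N∸d<b b≤N →
           reflexive (if-no (d N.≤? N ∸ b) λ d≤N∸b → ℕₚ.<⇒≱ N∸d<b (∸-swap b≤N d≤N∸b))) ⟩
    sum0 (N ∸ d) (λ b → if d ≤ᵇ N ∸ b then E b * F (N ∸ b ∸ d) else 0#)
      ≈⟨ sum0-cong (N ∸ d) (λ b b≤N∸d → reflexive (if-yes (d N.≤? N ∸ b) (∸-swap d≤N b≤N∸d))) ⟩
    sum0 (N ∸ d) (λ b → E b * F (N ∸ b ∸ d))
      ≈⟨ sum0-cong (N ∸ d) (λ b _ → reflexive (≡.cong₂ (λ x y → E x * F y) (≡.sym (ℕₚ.m+n∸n≡m b d)) (ℕₚ.∸-+-assoc N b d))) ⟩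
    sum0 (N ∸ d) (λ b → E (b N.+ d ∸ d) * F (N ∸ (b N.+ d)))
      ≈⟨ sum0-shift j N (λ b → E (b ∸ d) * F (N ∸ b)) d≤N ⟨
    sum0 N (λ b → if d ≤ᵇ b then E (b ∸ d) * F (N ∸ b) else 0#) ∎
    where
    d : ℕ
    d = suc j
    ∸-swap : ∀ {a b} → a ≤ N → b ≤ N ∸ a → a ≤ N ∸ b
    ∸-swap {a} {b} a≤N b≤N∸a = ℕₚ.m+n≤o⇒m≤o∸n a (≡.subst (_≤ N) (ℕₚ.+-comm b a) (ℕₚ.m≤o∸n⇒m+n≤o b a≤N b≤N∸a))
  ... | no d≰N =
    trans (sum0-≈0 N λ b _ → reflexive (if-no (suc j N.≤? N ∸ b) λ d≤N∸b → d≰N (ℕₚ.≤-trans d≤N∸b (ℕₚ.m∸n≤m N b))))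
          (sym (sum0-≈0 N λ b b≤N → reflexive (if-no (suc j N.≤? b) λ d≤b → d≰N (ℕₚ.≤-trans d≤b b≤N))))

  ι-partsUpTo-suc : ∀ k m → ι (partsUpTo (suc k) m) ≈
    ι (partsUpTo k m) + (if suc k ≤ᵇ m then ι (partsUpTo (suc k) (m ∸ suc k)) else 0#)
  ι-partsUpTo-suc k m = begin
    ι (partsUpTo (suc k) m)
      ≡⟨ ≡.cong ι (partsUpTo-suc k m) ⟩
    ι (partsUpTo k m N.+ (if suc k ≤ᵇ m then partsUpTo (suc k) (m ∸ suc k) else 0))
      ≈⟨ ι-+ (partsUpTo k m) _ ⟩
    ι (partsUpTo k m) + ι (if suc k ≤ᵇ m then partsUpTo (suc k) (m ∸ suc k) else 0)
      ≡⟨ ≡.cong (ι (partsUpTo k m) +_) (ι-if (suc k ≤ᵇ m) _) ⟩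
    ι (partsUpTo k m) + (if suc k ≤ᵇ m then ι (partsUpTo (suc k) (m ∸ suc k)) else 0#) ∎

  eulerPartial-partsUpTo-inverse : ∀ j N → sum0 N (λ b → eulerPartial j b * ι (partsUpTo j (N ∸ b))) ≈ δ N 0
  eulerPartial-partsUpTo-inverse zero zero    = trans (+-identityʳ _) (trans (*-identityˡ _) (+-identityʳ _))
  eulerPartial-partsUpTo-inverse zero (suc N) =
    trans (+-cong (zeroʳ _) (sum1-≈0 (suc N) λ where (suc b) _ _ → zeroˡ _)) (+-identityʳ _)
  eulerPartial-partsUpTo-inverse (suc j) N = begin
    sum0 N (λ b → eulerPartial (suc j) b * P′ (N ∸ b))
      ≈⟨ sum0-cong N (λ b _ → expand b) ⟩
    sum0 N (λ b → (A b + B b) + - C b)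
      ≈⟨ trans (sum0-distrib-+ N _ _) (+-cong (sum0-distrib-+ N A B) (sym (-‿distrib-sum0 N C))) ⟩
    (sum0 N A + sum0 N B) - sum0 N C
      ≈⟨ +-congʳ (+-cong (eulerPartial-partsUpTo-inverse j N) (sum0-shift-factor j N E P′)) ⟩
    (δ N 0 + sum0 N C) - sum0 N C
      ≈⟨ trans (+-assoc _ _ _) (trans (+-congˡ (-‿inverseʳ _)) (+-identityʳ _)) ⟩
    δ N 0 ∎
    where
    d : ℕ
    d = suc j
    E : ℕ → Carrier
    E = eulerPartial j
    P P′ : ℕ → Carrier
    P m  = ι (partsUpTo j m)
    P′ m = ι (partsUpTo d m)
    A B C : ℕ → Carrier
    A b = E b * P (N ∸ b)
    B b = if d ≤ᵇ N ∸ b then E b * P′ (N ∸ b ∸ d) else 0#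
    C b = if d ≤ᵇ b then E (b ∸ d) * P′ (N ∸ b) else 0#
    expand : ∀ b → eulerPartial d b * P′ (N ∸ b) ≈ (A b + B b) + - C b
    expand b = begin
      (E b - (if d ≤ᵇ b then E (b ∸ d) else 0#)) * P′ (N ∸ b)        ≈⟨ [y-z]x≈yx-zx _ _ _ ⟩
      E b * P′ (N ∸ b) - (if d ≤ᵇ b then E (b ∸ d) else 0#) * P′ (N ∸ b)
        ≈⟨ +-cong (trans (*-congˡ (ι-partsUpTo-suc j (N ∸ b))) (trans (distribˡ _ _ _) (+-congˡ (if-*ˡ (d ≤ᵇ N ∸ b) _ _))))
                  (-‿cong (if-*ʳ (d ≤ᵇ b) _ _)) ⟩
      (A b + B b) + - C b                                             ∎
  p e : ℕ → Carrier
  p m = ι (partition m)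
  e = eulerCoeff

  eulerPartial-saturates : ∀ j b → b ≤ j → eulerPartial j b ≈ eulerCoeff b
  eulerPartial-saturates j b b≤j =
    ≡.subst (λ j → eulerPartial j b ≈ eulerCoeff b) (ℕₚ.m∸n+n≡m b≤j) (beyond (j ∸ b))
    where
    beyond : ∀ d → eulerPartial (d N.+ b) b ≈ eulerCoeff b
    beyond zero    = refl
    beyond (suc d) = begin
      eulerPartial (d N.+ b) b - (if suc (d N.+ b) ≤ᵇ b then _ else 0#)
        ≡⟨ ≡.cong (λ x → eulerPartial (d N.+ b) b - x) (if-no (suc (d N.+ b) N.≤? b) (ℕₚ.<⇒≱ (s≤s (ℕₚ.m≤n+m b d)))) ⟩
      eulerPartial (d N.+ b) b - 0#
        ≈⟨ trans (+-congˡ -0#≈0#) (+-identityʳ _) ⟩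
      eulerPartial (d N.+ b) b
        ≈⟨ beyond d ⟩
      eulerCoeff b ∎

  eulerCoeff-partition-inverse : ∀ N → sum0 N (λ b → e b * p (N ∸ b)) ≈ δ N 0
  eulerCoeff-partition-inverse N = trans
    (sum0-cong N λ b b≤N → *-cong (sym (eulerPartial-saturates N b b≤N))
                                  (reflexive (≡.cong ι (≡.sym (partsUpTo-saturates N (N ∸ b) (ℕₚ.m∸n≤m N b))))))
    (eulerPartial-partsUpTo-inverse N N)

  partition-eulerCoeff-orthogonal : ∀ n r → 1 ≤ r → r ≤ n →
    sum1 n (λ l → if r ≤ᵇ l then p (n ∸ l) * e (l ∸ r) else 0#) ≈ δ r n
  partition-eulerCoeff-orthogonal n r@(suc j) _ r≤n = begin
    sum1 n G
      ≈⟨ +-identityˡ _ ⟨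
    sum0 n G
      ≈⟨ sum0-shift j n _ r≤n ⟩
    sum0 M (λ b → p (n ∸ (b N.+ r)) * e (b N.+ r ∸ r))
      ≈⟨ sum0-cong M (λ b _ → trans (*-comm _ _) (reflexive (≡.cong₂ (λ x y → e x * p y) (ℕₚ.m+n∸n≡m b r)
           (≡.trans (≡.cong (n ∸_) (ℕₚ.+-comm b r)) (≡.sym (ℕₚ.∸-+-assoc n r b)))))) ⟩
    sum0 M (λ b → e b * p (M ∸ b))
      ≈⟨ eulerCoeff-partition-inverse M ⟩
    δ M 0
      ≡⟨ ≡.cong (λ b → if b then 1# else 0#) (does-⇔ M≡0⇔r≡n (M N.≟ 0) (r N.≟ n)) ⟩
    δ r n ∎
    where
    M : ℕ
    M = n ∸ r
    G : ℕ → Carrier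
    G l = if r ≤ᵇ l then p (n ∸ l) * e (l ∸ r) else 0#
    M≡0⇔r≡n : M ≡ 0 ⇔ r ≡ n
    M≡0⇔r≡n = mk⇔ (λ M≡0 → ℕₚ.≤-antisym r≤n (ℕₚ.m∸n≡0⇒m≤n M≡0)) (λ { ≡.refl → ℕₚ.n∸n≡0 n })

  partition-inversion : ∀ (w a : ℕ → Carrier) n → 1 ≤ n →
    (∀ l → 1 ≤ l → l ≤ n → sum1 l (λ r → e (l ∸ r) * w r) ≈ a l) →
    w n ≈ sum1 n (λ l → p (n ∸ l) * a l)
  partition-inversion w a n 1≤n e⋆w≈a = begin
    w n
      ≈⟨ trans (*-congʳ (reflexive (if-yes (n N.≟ n) ≡.refl))) (*-identityˡ _) ⟨
    δ n n * w n
      ≈⟨ sum1-single n n 1≤n ℕₚ.≤-refl (λ r _ _ r≢n → trans (*-congʳ (reflexive (if-no (r N.≟ n) r≢n))) (zeroˡ _)) ⟨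
    sum1 n (λ r → δ r n * w r)
      ≈⟨ sum1-cong n (λ r 1≤r r≤n → *-congʳ (partition-eulerCoeff-orthogonal n r 1≤r r≤n)) ⟨
    sum1 n (λ r → sum1 n (λ l → if r ≤ᵇ l then p (n ∸ l) * e (l ∸ r) else 0#) * w r)
      ≈⟨ sum1-cong n (λ r _ _ → trans (*-distribʳ-sum1 n (w r) _) (sum1-cong n λ l _ _ →
           trans (if-*ʳ (r ≤ᵇ l) _ _) (if-cong (r N.≤? l) λ _ → *-assoc _ _ _))) ⟩
    sum1 n (λ r → sum1 n (λ l → if r ≤ᵇ l then p (n ∸ l) * (e (l ∸ r) * w r) else 0#))
      ≈⟨ sum1-comm n n _ ⟩
    sum1 n (λ l → sum1 n (λ r → if r ≤ᵇ l then p (n ∸ l) * (e (l ∸ r) * w r) else 0#))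
      ≈⟨ sum1-cong n (λ l _ l≤n → trans (sum1-truncate l n _ l≤n) (sym (*-distribˡ-sum1 l (p (n ∸ l)) _))) ⟩
    sum1 n (λ l → p (n ∸ l) * sum1 l (λ r → e (l ∸ r) * w r))
      ≈⟨ sum1-cong n (λ l 1≤l l≤n → *-congˡ (e⋆w≈a l 1≤l l≤n)) ⟩
    sum1 n (λ l → p (n ∸ l) * a l) ∎

  partition-δ : ∀ k n → 1 ≤ k → sum1 n (λ l → p (n ∸ l) * δ l k) ≈ pₖ k n
  partition-δ k n 1≤k with k N.≤? n
  ... | yes k≤n = begin
    sum1 n (λ l → p (n ∸ l) * δ l k)
      ≈⟨ sum1-single n k 1≤k k≤n (λ l _ _ l≢k → trans (*-congˡ (reflexive (if-no (l N.≟ k) l≢k))) (zeroʳ _)) ⟩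
    p (n ∸ k) * δ k k
      ≈⟨ trans (*-congˡ (reflexive (if-yes (k N.≟ k) ≡.refl))) (*-identityʳ _) ⟩
    p (n ∸ k)
      ≡⟨ if-yes (k N.≤? n) k≤n ⟨
    pₖ k n ∎
  ... | no k≰n = trans (sum1-≈0 n λ l _ l≤n →
                          trans (*-congˡ (reflexive (if-no (l N.≟ k) λ { ≡.refl → k≰n l≤n }))) (zeroʳ _))
                       (reflexive (≡.sym (if-no (k N.≤? n) k≰n)))

  s̃-column : ∀ g f n → sum1 n (λ m → s̃ g n m * f m) ≈ sum1 n (λ r → e (n ∸ r) * (g ⋆ (f ⋆ 𝟙)) r)
  s̃-column g f n = trans lhs (sym rhs)
    where
    X : ℕ → ℕ → ℕ → Carrier
    X j m i = if j N.* (m N.* i) ≤ᵇ n then e (n ∸ j N.* (m N.* i)) * (g j * f m) else 0#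
    Y : ℕ → ℕ → ℕ → ℕ → Carrier
    Y j m i r = if j N.* (m N.* i) ≡ᵇ r then e (n ∸ r) * (g j * (f m * 1#)) else 0#
    lhs : sum1 n (λ m → s̃ g n m * f m) ≈ sum1 n λ j → sum1 n λ m → sum1 n λ i → X j m i
    lhs = begin
      sum1 n (λ m → sum1 n (λ j → s n (m N.* j) * g j) * f m)
        ≈⟨ sum1-cong n (λ m _ _ → trans (*-distribʳ-sum1 n (f m) _) (sum1-cong n λ j _ _ →
             trans (*-assoc _ _ _) (trans (*-distribʳ-sum1 n _ _) (sum1-cong n λ i _ _ → if-*ʳ (i N.* (m N.* j) ≤ᵇ n) _ _)))) ⟩
      sum1 n (λ m → sum1 n λ j → sum1 n λ i → if i N.* (m N.* j) ≤ᵇ n then e (n ∸ i N.* (m N.* j)) * (g j * f m) else 0#)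
        ≈⟨ sum1-comm n n _ ⟩
      sum1 n (λ j → sum1 n λ m → sum1 n λ i → if i N.* (m N.* j) ≤ᵇ n then e (n ∸ i N.* (m N.* j)) * (g j * f m) else 0#)
        ≈⟨ sum1-cong n (λ j _ _ → sum1-cong n λ m _ _ → sum1-cong n λ i _ _ →
             reflexive (≡.cong (λ x → if x ≤ᵇ n then e (n ∸ x) * (g j * f m) else 0#) (reverse i m j))) ⟩
      sum1 n (λ j → sum1 n λ m → sum1 n λ i → X j m i) ∎
      where
      reverse : ∀ i m j → i N.* (m N.* j) ≡ j N.* (m N.* i)
      reverse i m j = ≡.trans (≡.sym (ℕₚ.*-assoc i m j)) (≡.trans (ℕₚ.*-comm (i N.* m) j) (≡.cong (j N.*_) (ℕₚ.*-comm i m)))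
    rhs : sum1 n (λ r → e (n ∸ r) * (g ⋆ (f ⋆ 𝟙)) r) ≈ sum1 n λ j → sum1 n λ m → sum1 n λ i → X j m i
    rhs = begin
      sum1 n (λ r → e (n ∸ r) * (g ⋆ (f ⋆ 𝟙)) r)
        ≈⟨ sum1-cong n (λ r 1≤r r≤n → trans (*-congˡ (⋆-⋆≈divisorTripleSum g f 𝟙 n r 1≤r r≤n))
             (trans (*-distribˡ-sum1 n _ _) (sum1-cong n λ j _ _ → trans (*-distribˡ-sum1 n _ _) (sum1-cong n λ m _ _ →
               trans (*-distribˡ-sum1 n _ _) (sum1-cong n λ i _ _ → if-*ˡ (j N.* (m N.* i) ≡ᵇ r) _ _))))) ⟩
      sum1 n (λ r → sum1 n λ j → sum1 n λ m → sum1 n λ i → Y j m i r)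
        ≈⟨ trans (sum1-comm n n _) (sum1-cong n λ j _ _ → trans (sum1-comm n n _) (sum1-cong n λ m _ _ → sum1-comm n n _)) ⟩
      sum1 n (λ j → sum1 n λ m → sum1 n λ i → sum1 n λ r → Y j m i r)
        ≈⟨ sum1-cong n (λ j 1≤j _ → sum1-cong n λ m 1≤m _ → sum1-cong n λ i 1≤i _ →
             trans (sum1-indicator n (j N.* (m N.* i)) _ (ℕₚ.*-mono-≤ 1≤j (ℕₚ.*-mono-≤ 1≤m 1≤i)))
                   (if-cong (j N.* (m N.* i) N.≤? n) λ _ → *-congˡ (*-congˡ (*-identityʳ (f m))))) ⟩
      sum1 n (λ j → sum1 n λ m → sum1 n λ i → X j m i) ∎

  infixr 30 _^⋆_
  _^⋆_ : (ℕ → Carrier) → ℕ → ℕ → Carrier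
  f ^⋆ zero  = δ₁
  f ^⋆ suc j = f ⋆ (f ^⋆ j)

  ^⋆-vanishes : ∀ f ρ → f 1 ≈ 0# → DecreasesOnProperDivisors ρ → ∀ j m → 1 ≤ m → ρ m < j → (f ^⋆ j) m ≈ 0#
  ^⋆-vanishes f ρ f1≈0 ρ↓ (suc j) m 1≤m ρm≤j = ⋆-≈0-divisors m 1≤m λ where
    (suc zero) b _ _ _ → trans (*-congʳ f1≈0) (zeroˡ _)
    a@(suc (suc _)) b _ 1≤b ab≡m → trans (*-congˡ (^⋆-vanishes f ρ f1≈0 ρ↓ j b 1≤b
      (ℕₚ.<-≤-trans (≡.subst (ρ b <_) (≡.cong ρ ab≡m) (ρ↓ a b (s≤s (s≤s z≤n)) 1≤b)) (ℕₚ.≤-pred ρm≤j)))) (zeroʳ _)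

  module DirichletInverseOf (g : ℕ → Carrier) (g1≈1 : g 1 ≈ 1#) where

    g₀ : ℕ → Carrier
    g₀ = g ⊖ δ₁

    g₀-1 : g₀ 1 ≈ 0#
    g₀-1 = trans (+-congʳ g1≈1) (-‿inverseʳ 1#)

    g₀-≥2 : ∀ m → g₀ (suc (suc m)) ≈ g (suc (suc m))
    g₀-≥2 m = trans (+-congˡ -0#≈0#) (+-identityʳ _)

    g≋δ₁⊕g₀ : g ≋ δ₁ ⊕ g₀
    g≋δ₁⊕g₀ n _ = sym (trans (+-congˡ (+-comm (g n) _)) (trans (sym (+-assoc _ _ _))
                                 (trans (+-congʳ (-‿inverseʳ _)) (+-identityˡ _))))

    dsStep≋g₀⋆ : ∀ f → dsStep g f ≋ g₀ ⋆ f
    dsStep≋g₀⋆ f n _ = sum1-cong n λ where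
      (suc zero)    _ _ → sym (if-≈0 (1 ∣? n) λ _ → trans (*-congʳ g₀-1) (zeroˡ _))
      (suc (suc i)) _ _ → if-cong (suc (suc i) ∣? n) λ _ → *-congʳ (sym (g₀-≥2 i))

    ds≋^⋆-difference : ∀ J → ds (suc J) g ≋ g₀ ^⋆ suc J ⊖ g₀ ^⋆ J
    ds≋^⋆-difference zero (suc zero) _ =
      sym (trans (+-congʳ (trans (⋆-identityʳ g₀ 1 (s≤s z≤n)) g₀-1)) (+-identityˡ _))
    ds≋^⋆-difference zero (suc (suc m)) _ =
      sym (trans (+-congʳ (trans (⋆-identityʳ g₀ (2 N.+ m) (s≤s z≤n)) (g₀-≥2 m))) (trans (+-congˡ -0#≈0#) (+-identityʳ _)))
    ds≋^⋆-difference (suc J) n 1≤n = begin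
      dsStep g (ds (suc J) g) n                     ≈⟨ dsStep≋g₀⋆ (ds (suc J) g) n 1≤n ⟩
      (g₀ ⋆ ds (suc J) g) n                         ≈⟨ ⋆-congˡ (ds≋^⋆-difference J) n 1≤n ⟩
      (g₀ ⋆ (g₀ ^⋆ suc J ⊖ g₀ ^⋆ J)) n              ≈⟨ ⋆-distribˡ-⊖ g₀ (g₀ ^⋆ suc J) (g₀ ^⋆ J) n 1≤n ⟩
      (g₀ ^⋆ suc (suc J) ⊖ g₀ ^⋆ suc J) n           ∎

    ^⋆-⋆-g : ∀ j → g₀ ^⋆ j ⋆ g ≋ g₀ ^⋆ j ⊕ g₀ ^⋆ suc j
    ^⋆-⋆-g j n 1≤n = begin
      (g₀ ^⋆ j ⋆ g) n                       ≈⟨ ⋆-congˡ g≋δ₁⊕g₀ n 1≤n ⟩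
      (g₀ ^⋆ j ⋆ (δ₁ ⊕ g₀)) n               ≈⟨ ⋆-distribˡ-⊕ (g₀ ^⋆ j) δ₁ g₀ n 1≤n ⟩
      (g₀ ^⋆ j ⋆ δ₁) n + (g₀ ^⋆ j ⋆ g₀) n   ≈⟨ +-cong (⋆-identityʳ (g₀ ^⋆ j) n 1≤n) (⋆-comm (g₀ ^⋆ j) g₀ n 1≤n) ⟩
      (g₀ ^⋆ j ⊕ g₀ ^⋆ suc j) n             ∎

    ds-⋆-g : ∀ J → ds (suc J) g ⋆ g ≋ g₀ ^⋆ suc (suc J) ⊖ g₀ ^⋆ J
    ds-⋆-g J n 1≤n = begin
      (ds (suc J) g ⋆ g) n                                  ≈⟨ ⋆-congʳ (ds≋^⋆-difference J) n 1≤n ⟩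
      ((g₀ ^⋆ suc J ⊖ g₀ ^⋆ J) ⋆ g) n                       ≈⟨ ⋆-distribʳ-⊖ g (g₀ ^⋆ suc J) (g₀ ^⋆ J) n 1≤n ⟩
      (g₀ ^⋆ suc J ⋆ g) n - (g₀ ^⋆ J ⋆ g) n                 ≈⟨ +-cong (^⋆-⋆-g (suc J) n 1≤n) (-‿cong (^⋆-⋆-g J n 1≤n)) ⟩
      (g₀ ^⋆ suc J ⊕ g₀ ^⋆ suc (suc J)) n - (g₀ ^⋆ J ⊕ g₀ ^⋆ suc J) n  ≈⟨ [x+z]-[y+x]≈z-y _ _ _ ⟩
      (g₀ ^⋆ suc (suc J) ⊖ g₀ ^⋆ J) n                       ∎

    approxInverse : ℕ → ℕ → Carrier
    approxInverse M = δ₁ ⊕ (λ x → sum1 M (λ j → ds (2 N.* j) g x))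

    approxInverse-⋆-g : ∀ M → approxInverse M ⋆ g ≋ δ₁ ⊕ g₀ ^⋆ suc (2 N.* M)
    approxInverse-⋆-g zero n 1≤n = begin
      (approxInverse 0 ⋆ g) n   ≈⟨ ⋆-congʳ (λ x _ → +-identityʳ (δ₁ x)) n 1≤n ⟩
      (δ₁ ⋆ g) n                ≈⟨ ⋆-identityˡ g n 1≤n ⟩
      g n                       ≈⟨ g≋δ₁⊕g₀ n 1≤n ⟩
      δ₁ n + g₀ n               ≈⟨ +-congˡ (⋆-identityʳ g₀ n 1≤n) ⟨
      δ₁ n + (g₀ ^⋆ 1) n        ∎
    approxInverse-⋆-g (suc M) n 1≤n = begin
      (approxInverse (suc M) ⋆ g) n
        ≈⟨ ⋆-congʳ (λ x _ → sym (+-assoc _ _ _)) n 1≤n ⟩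
      ((approxInverse M ⊕ ds (suc J) g) ⋆ g) n
        ≈⟨ ⋆-distribʳ-⊕ g (approxInverse M) (ds (suc J) g) n 1≤n ⟩
      (approxInverse M ⋆ g) n + (ds (suc J) g ⋆ g) n
        ≈⟨ +-cong (approxInverse-⋆-g M n 1≤n) (ds-⋆-g J n 1≤n) ⟩
      (δ₁ n + (g₀ ^⋆ suc (2 N.* M)) n) + ((g₀ ^⋆ suc (suc J)) n - (g₀ ^⋆ J) n)
        ≡⟨ ≡.cong (λ i → (δ₁ n + (g₀ ^⋆ suc (2 N.* M)) n) + ((g₀ ^⋆ suc (suc J)) n - (g₀ ^⋆ i) n)) (ℕₚ.+-suc M (M N.+ 0)) ⟩
      (δ₁ n + (g₀ ^⋆ suc (2 N.* M)) n) + ((g₀ ^⋆ suc (suc J)) n - (g₀ ^⋆ suc (2 N.* M)) n)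
        ≈⟨ [x+y]+[z-y]≈x+z _ _ _ ⟩
      δ₁ n + (g₀ ^⋆ suc (2 N.* suc M)) n ∎
      where
      -- 2 N.* suc M reduces to suc J
      J : ℕ
      J = M N.+ suc (M N.+ 0)

    ds-even-vanishes : ∀ ρ → DecreasesOnProperDivisors ρ → ∀ j m → 1 ≤ m → ρ m < j → ds (2 N.* j) g m ≈ 0#
    ds-even-vanishes ρ ρ↓ (suc j) m 1≤m ρm<j = begin
      ds (suc J) g m                          ≈⟨ ds≋^⋆-difference J m 1≤m ⟩
      (g₀ ^⋆ suc J) m - (g₀ ^⋆ J) m           ≈⟨ +-cong (vanishes (suc J) (ℕₚ.m≤n⇒m≤1+n ρm<J)) (-‿cong (vanishes J ρm<J)) ⟩
      0# - 0#                                 ≈⟨ -‿inverseʳ 0# ⟩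
      0#                                      ∎
      where
      J : ℕ
      J = j N.+ suc (j N.+ 0)
      ρm<J : ρ m < J
      ρm<J = ℕₚ.<-≤-trans ρm<j (ℕₚ.m<m+n j (s≤s z≤n))
      vanishes : ∀ i → ρ m < i → (g₀ ^⋆ i) m ≈ 0#
      vanishes i = ^⋆-vanishes g₀ ρ g₀-1 ρ↓ i m 1≤m

    D≈sum1-ds : ∀ ρ → DecreasesOnProperDivisors ρ → ∀ B m → 1 ≤ m → ρ m ≤ B → D g m ≈ sum1 B (λ j → ds (2 N.* j) g m)
    D≈sum1-ds ρ ρ↓ B m 1≤m ρm≤B = sum1-vanishing-tails m B
      (λ j m<j → ds-even-vanishes N.pred pred-decreases j m 1≤m (ℕₚ.≤-<-trans ℕₚ.pred[n]≤n m<j))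
      (λ j B<j → ds-even-vanishes ρ ρ↓ j m 1≤m (ℕₚ.≤-<-trans ρm≤B B<j))

    δ₁⊕D⋆g≋δ₁ : (δ₁ ⊕ D g) ⋆ g ≋ δ₁
    δ₁⊕D⋆g≋δ₁ n 1≤n = begin
      ((δ₁ ⊕ D g) ⋆ g) n                      ≈⟨ ⋆-cong-divisors n 1≤n (λ a b 1≤a 1≤b ab≡n → *-congʳ (+-congˡ
                                                   (D≈sum1-ds N.pred pred-decreases n a 1≤a
                                                     (ℕₚ.≤-trans ℕₚ.pred[n]≤n (*≡⇒≤ˡ {a} 1≤b ab≡n))))) ⟩
      (approxInverse n ⋆ g) n                 ≈⟨ approxInverse-⋆-g n n 1≤n ⟩
      δ₁ n + (g₀ ^⋆ suc (2 N.* n)) n          ≈⟨ +-congˡ (^⋆-vanishes g₀ N.pred g₀-1 pred-decreases _ n 1≤n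
                                                   (ℕₚ.≤-<-trans ℕₚ.pred[n]≤n (s≤s (ℕₚ.m≤m+n n _)))) ⟩
      δ₁ n + 0#                               ≈⟨ +-identityʳ _ ⟩
      δ₁ n                                    ∎

    g⋆u≋q⇒u≋q⊕q⋆D : ∀ u q → g ⋆ u ≋ q → u ≋ q ⊕ (q ⋆ D g)
    g⋆u≋q⇒u≋q⊕q⋆D u q g⋆u≋q n 1≤n = begin
      u n                               ≈⟨ ⋆-identityˡ u n 1≤n ⟨
      (δ₁ ⋆ u) n                        ≈⟨ ⋆-congʳ δ₁⊕D⋆g≋δ₁ n 1≤n ⟨
      (((δ₁ ⊕ D g) ⋆ g) ⋆ u) n          ≈⟨ ⋆-assoc (δ₁ ⊕ D g) g u n 1≤n ⟩
      ((δ₁ ⊕ D g) ⋆ (g ⋆ u)) n          ≈⟨ ⋆-congˡ g⋆u≋q n 1≤n ⟩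
      ((δ₁ ⊕ D g) ⋆ q) n                ≈⟨ ⋆-distribʳ-⊕ q δ₁ (D g) n 1≤n ⟩
      (δ₁ ⋆ q) n + (D g ⋆ q) n          ≈⟨ +-cong (⋆-identityˡ q n 1≤n) (⋆-comm (D g) q n 1≤n) ⟩
      q n + (q ⋆ D g) n                 ∎

    ⋆D≈sum1-ds : ∀ f B n → 1 ≤ n → Ω n ≤ B → (f ⋆ D g) n ≈ sum1 B (λ j → (f ⋆ ds (2 N.* j) g) n)
    ⋆D≈sum1-ds f B n 1≤n Ωn≤B = trans
      (⋆-cong-divisors n 1≤n λ a b 1≤a 1≤b ab≡n → *-congˡ (D≈sum1-ds Ω Ω-decreases B b 1≤b
        (ℕₚ.≤-trans (≡.subst (λ x → Ω b ≤ Ω x) ab≡n (Ω-≤-* a b 1≤a 1≤b)) Ωn≤B)))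
      (⋆-distrib-sum1 f B (λ j → ds (2 N.* j) g) n 1≤n)

    ⋆D⋆≈sum1-ds : ∀ f h B n → 1 ≤ n → Ω n ≤ B → ((f ⋆ D g) ⋆ h) n ≈ sum1 B (λ j → ((f ⋆ ds (2 N.* j) g) ⋆ h) n)
    ⋆D⋆≈sum1-ds f h B n 1≤n Ωn≤B = trans
      (⋆-cong-divisors n 1≤n λ a b 1≤a 1≤b ab≡n → *-congʳ (⋆D≈sum1-ds f B a 1≤a
        (ℕₚ.≤-trans (≡.subst (λ x → Ω a ≤ Ω x) (≡.trans (ℕₚ.*-comm b a) ab≡n) (Ω-≤-* b a 1≤b 1≤a)) Ωn≤B)))
      (sum1-distrib-⋆ h B (λ j → f ⋆ ds (2 N.* j) g) n 1≤n)

  g⋆divisorSums≋pₖ : ∀ g t → IsInverseOfS̃ g t → ∀ k → 1 ≤ k → g ⋆ ((λ m → t m k) ⋆ 𝟙) ≋ pₖ k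
  g⋆divisorSums≋pₖ g t (_ , s̃t≈δ , _) k 1≤k n 1≤n = begin
    (g ⋆ (column ⋆ 𝟙)) n                ≈⟨ partition-inversion (g ⋆ (column ⋆ 𝟙)) (λ l → δ l k) n 1≤n (λ l 1≤l _ →
                                            trans (sym (s̃-column g column l)) (s̃t≈δ l k 1≤l 1≤k)) ⟩
    sum1 n (λ l → p (n ∸ l) * δ l k)    ≈⟨ partition-δ k n 1≤k ⟩
    pₖ k n                               ∎
    where
    column : ℕ → Carrier
    column m = t m k

theorem4p2 : ∀ {c ℓ : Level} (R : CommutativeRing c ℓ) →
  let open CommutativeRing R
      open WithRing R
  in (g : ℕ → Carrier) → g 1 ≈ 1# →
     (t : ℕ → ℕ → Carrier) → IsInverseOfS̃ g t →
     ∀ n k → 1 N.≤ n → 1 N.≤ k →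
       (divSum n (λ d → t d k)
          ≈ pₖ k n + sum1 (Ω n) (λ j → (pₖ k ⋆ ds (2 N.* j) g) n))
     × (divSum n (λ d → t d k) ≈ pₖ k n + (pₖ k ⋆ D g) n)
     × (t n k
          ≈ (pₖ k ⋆ μ) n + sum1 (Ω n) (λ j → ((pₖ k ⋆ ds (2 N.* j) g) ⋆ μ) n))
     × (t n k ≈ (pₖ k ⋆ μ) n + ((pₖ k ⋆ D g) ⋆ μ) n)
theorem4p2 R g g1≈1 t t-inv n k 1≤n 1≤k =
    trans divisorSum (+-congˡ (⋆D≈sum1-ds (pₖ k) (Ω n) n 1≤n ℕₚ.≤-refl))
  , divisorSum
  , trans entry (+-congˡ (⋆D⋆≈sum1-ds (pₖ k) μ (Ω n) n 1≤n ℕₚ.≤-refl))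
  , entry
  where
  open CommutativeRing R
  open WithRing R
  open ArithmeticFunctions R
  open DirichletInverseOf g g1≈1
  open import Relation.Binary.Reasoning.Setoid setoid

  column : ℕ → Carrier
  column m = t m k

  divisorSums : column ⋆ 𝟙 ≋ pₖ k ⊕ (pₖ k ⋆ D g)
  divisorSums = g⋆u≋q⇒u≋q⊕q⋆D (column ⋆ 𝟙) (pₖ k) (g⋆divisorSums≋pₖ g t t-inv k 1≤k)

  divisorSum : divSum n column ≈ pₖ k n + (pₖ k ⋆ D g) n
  divisorSum = trans (divSum≈⋆𝟙 column n) (divisorSums n 1≤n)

  entry : t n k ≈ (pₖ k ⋆ μ) n + ((pₖ k ⋆ D g) ⋆ μ) n
  entry = begin
    t n k                                     ≈⟨ möbius-inversion column n 1≤n ⟨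
    ((column ⋆ 𝟙) ⋆ μ) n                      ≈⟨ ⋆-congʳ divisorSums n 1≤n ⟩
    ((pₖ k ⊕ (pₖ k ⋆ D g)) ⋆ μ) n             ≈⟨ ⋆-distribʳ-⊕ μ (pₖ k) (pₖ k ⋆ D g) n 1≤n ⟩
    (pₖ k ⋆ μ) n + ((pₖ k ⋆ D g) ⋆ μ) n       ∎
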